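{- There exists a punctual copy $\mathcal{B} = (\mathbb{N}, S^{\mathcal{B}})$ of $\mathcal{S} = (\mathbb{N}, S)$ such that the standard ordering and addition are primitive recursive on $\mathcal{B}$, but whenever $f:\mathbb{N}\to\mathbb{N}$ is a primitive recursive function with $f(x) > x^2$ for all sufficiently large $x$, $f$ is not primitive recursive on $\mathcal{B}$.
   Context: $S$ denotes the successor function on $\mathbb{N}$. A copy of $\mathcal{S}$ is a structure $\mathcal{B} = (\mathbb{N}, S^{\mathcal{B}})$ isomorphic to $(\mathbb{N}, S)$; it is punctual if $S^{\mathcal{B}}$ is primitive recursive. Let $c: (\mathbb{N}, S)\to\mathcal{B}$ be the isomorphism. For $f:\mathbb{N}^k\to\mathbb{N}$, $f^{\mathcal{B}}(x_1,\dots,x_k) = c(f(c^{ -1}(x_1),\dots,c^{ -1}(x_k)))$, and $f$ is primitive recursive on $\mathcal{B}$ if $f^{\mathcal{B}}$ is primitive recursive. For a relation $R$, its image $R^{\mathcal{B}}$ is defined by $R^{\mathcal{B}}(x_1,\dots,x_k) \iff R(c^{ -1}(x_1),\dots,c^{ -1}(x_k))$, and $R$ is primitive recursive on $\mathcal{B}$ if $R^{\mathcal{B}}$ has a primitive recursive characteristic function. -}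

module Defs where

open import Data.Nat using (ℕ; zero; suc; _+_; _*_; _≤_; _<_)
open import Data.Fin using (Fin)
open import Data.Vec using (Vec; []; _∷_; lookup)
open import Data.Product using (Σ; _×_; _,_; ∃)
open import Data.Sum using (_⊎_)
open import Relation.Nullary using (¬_)
open import Relation.Binary.PropositionalEquality using (_≡_)
open import Function.Bundles using (_↔_; Inverse)

data PR : ℕ → Set where
  Z    : ∀ {n} → PR n
  S    : PR 1
  P    : ∀ {n} → Fin n → PR n
  comp : ∀ {m n} → PR m → Vec (PR n) m → PR n
  rec  : ∀ {n} → PR n → PR (suc (suc n)) → PR (suc n)

mutual
  eval : ∀ {n} → PR n → Vec ℕ n → ℕ
  eval Z xs = 0
  eval S (x ∷ []) = suc x
  eval (P i) xs = lookup xs i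
  eval (comp f gs) xs = eval f (evalAll gs xs)
  eval (rec g h) (y ∷ xs) = evalRec g h y xs

  evalAll : ∀ {m n} → Vec (PR n) m → Vec ℕ n → Vec ℕ m
  evalAll [] xs = []
  evalAll (g ∷ gs) xs = eval g xs ∷ evalAll gs xs

  evalRec : ∀ {n} → PR n → PR (suc (suc n)) → ℕ → Vec ℕ n → ℕ
  evalRec g h zero xs = eval g xs
  evalRec g h (suc y) xs = eval h (evalRec g h y xs ∷ y ∷ xs)

PrimRec₁ : (ℕ → ℕ) → Set
PrimRec₁ f = Σ (PR 1) λ p → ∀ x → eval p (x ∷ []) ≡ f x

PrimRec₂ : (ℕ → ℕ → ℕ) → Set
PrimRec₂ f = Σ (PR 2) λ p → ∀ x y → eval p (x ∷ y ∷ []) ≡ f x y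

PrimRecRel₂ : (ℕ → ℕ → Set) → Set
PrimRecRel₂ R = Σ (PR 2) λ p → ∀ x y →
  (eval p (x ∷ y ∷ []) ≡ 1 × R x y) ⊎ (eval p (x ∷ y ∷ []) ≡ 0 × ¬ R x y)

IsCopyIso : (ℕ → ℕ) → (ℕ ↔ ℕ) → Set
IsCopyIso sB c = ∀ n → Inverse.to c (suc n) ≡ sB (Inverse.to c n)

image₁ : (ℕ ↔ ℕ) → (ℕ → ℕ) → ℕ → ℕ
image₁ c f x = Inverse.to c (f (Inverse.from c x))

image₂ : (ℕ ↔ ℕ) → (ℕ → ℕ → ℕ) → ℕ → ℕ → ℕ
image₂ c f x y = Inverse.to c (f (Inverse.from c x) (Inverse.from c y))

imageRel₂ : (ℕ ↔ ℕ) → (ℕ → ℕ → Set) → ℕ → ℕ → Set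
imageRel₂ c R x y = R (Inverse.from c x) (Inverse.from c y)

EventuallyAboveSquare : (ℕ → ℕ) → Set
EventuallyAboveSquare f = ∃ λ N → ∀ x → N ≤ x → x * x < f x

module Submission where

-- The copy writes n in a mixed radix: the digit at position j ranges below radix j, which
-- exceeds ack j (place j), where place j is the product of the lower radices. Digit strings
-- are coded by iterated Cantor pairing, and the copy numbers the valid codes in increasing
-- order. Successor, addition and comparison act digit by digit on codes; whether a digit a
-- has reached radix j is decided by running a stack machine for Ackermann's function for
-- only a + 1 steps, so all three are primitive recursive on the copy.
-- Conversely, place j has the short code of 0 ⋯ 0 1, while a value above place j * place j
-- and below place (suc j) has top digit, hence code, at least place j > ack (j ∸ 1) j. A
-- primitive recursive image of f is bounded by some ack k, so it cannot turn the short code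
-- of place j into the long code of f (place j) once j is large.

open import Defs
open import Data.Nat
  using (ℕ; zero; suc; pred; _+_; _*_; _∸_; _⊓_; _⊔_; _≤_; _<_; z≤n; s≤s; z<s; _≤′_; ≤′-refl; ≤′-step; NonZero; >-nonZero)
open import Data.Nat.Properties
open import Data.Fin using (Fin) renaming (zero to fzero; suc to fsuc)
open import Data.Vec using (Vec; []; _∷_; lookup; head; tail; tabulate)
open import Data.Vec.Properties using (tabulate∘lookup)
open import Data.Product using (Σ; _×_; _,_; proj₁; proj₂; ∃₂; ∃)
open import Data.Sum using (_⊎_; inj₁; inj₂; [_,_]′)
open import Data.Empty using (⊥-elim)
open import Relation.Nullary using (¬_)
open import Relation.Binary.PropositionalEquality
open import Relation.Binary.Definitions using (tri<; tri≈; tri>)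
open import Data.List using (List; []; _∷_; length; drop)
open import Data.List.Properties using (drop-all)
open import Data.Unit using (⊤; tt)
open import Data.Nat.Solver using (module +-*-Solver)
open import Function.Bundles using (_↔_; mk↔ₛ′)

stepwise-mono-≤ : (f : ℕ → ℕ) → (∀ n → f n ≤ f (suc n)) → ∀ {m n} → m ≤ n → f m ≤ f n
stepwise-mono-≤ f step m≤n = go (≤⇒≤′ m≤n)
  where
  go : ∀ {m n} → m ≤′ n → f m ≤ f n
  go ≤′-refl = ≤-refl
  go (≤′-step m≤′n) = ≤-trans (go m≤′n) (step _)

stepwise-mono-< : (f : ℕ → ℕ) → (∀ n → f n < f (suc n)) → ∀ {m n} → m < n → f m < f n
stepwise-mono-< f step m<n = go (≤⇒≤′ m<n)
  where
  go : ∀ {m n} → suc m ≤′ n → f m < f n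
  go ≤′-refl = step _
  go (≤′-step m<′n) = <-trans (go m<′n) (step _)

PrimRecV : (n : ℕ) → (Vec ℕ n → ℕ) → Set
PrimRecV n f = Σ (PR n) λ p → ∀ xs → eval p xs ≡ f xs

PrimRecVs : (n m : ℕ) → (Vec ℕ n → Vec ℕ m) → Set
PrimRecVs n m fs = Σ (Vec (PR n) m) λ ps → ∀ xs → evalAll ps xs ≡ fs xs

PrimRec₃ : (ℕ → ℕ → ℕ → ℕ) → Set
PrimRec₃ f = Σ (PR 3) λ p → ∀ x y z → eval p (x ∷ y ∷ z ∷ []) ≡ f x y z

PrimRec₄ : (ℕ → ℕ → ℕ → ℕ → ℕ) → Set
PrimRec₄ f = Σ (PR 4) λ p → ∀ x y z u → eval p (x ∷ y ∷ z ∷ u ∷ []) ≡ f x y z u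

PrimRec₅ : (ℕ → ℕ → ℕ → ℕ → ℕ → ℕ) → Set
PrimRec₅ f = Σ (PR 5) λ p → ∀ x y z u v → eval p (x ∷ y ∷ z ∷ u ∷ v ∷ []) ≡ f x y z u v

curry₁ : ∀ {f} → PrimRecV 1 f → PrimRec₁ (λ x → f (x ∷ []))
curry₁ (p , e) = p , λ x → e (x ∷ [])

curry₂ : ∀ {f} → PrimRecV 2 f → PrimRec₂ (λ x y → f (x ∷ y ∷ []))
curry₂ (p , e) = p , λ x y → e (x ∷ y ∷ [])

curry₃ : ∀ {f} → PrimRecV 3 f → PrimRec₃ (λ x y z → f (x ∷ y ∷ z ∷ []))
curry₃ (p , e) = p , λ x y z → e (x ∷ y ∷ z ∷ [])

curry₄ : ∀ {f} → PrimRecV 4 f → PrimRec₄ (λ x y z u → f (x ∷ y ∷ z ∷ u ∷ []))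
curry₄ (p , e) = p , λ x y z u → e (x ∷ y ∷ z ∷ u ∷ [])

curry₅ : ∀ {f} → PrimRecV 5 f → PrimRec₅ (λ x y z u v → f (x ∷ y ∷ z ∷ u ∷ v ∷ []))
curry₅ (p , e) = p , λ x y z u v → e (x ∷ y ∷ z ∷ u ∷ v ∷ [])

pr-ext₁ : ∀ {f g} → (∀ x → g (x ∷ []) ≡ f x) → PrimRecV 1 g → PrimRec₁ f
pr-ext₁ g≗f (p , e) = p , λ x → trans (e (x ∷ [])) (g≗f x)

pr-ext₂ : ∀ {f g} → (∀ x y → g (x ∷ y ∷ []) ≡ f x y) → PrimRecV 2 g → PrimRec₂ f
pr-ext₂ g≗f (p , e) = p , λ x y → trans (e (x ∷ y ∷ [])) (g≗f x y)

pr-ext₃ : ∀ {f g} → (∀ x y z → g (x ∷ y ∷ z ∷ []) ≡ f x y z) → PrimRecV 3 g → PrimRec₃ f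
pr-ext₃ g≗f (p , e) = p , λ x y z → trans (e (x ∷ y ∷ z ∷ [])) (g≗f x y z)

pr-zero : ∀ {n} → PrimRecV n (λ _ → 0)
pr-zero = Z , λ _ → refl

pr-var : ∀ {n} (i : Fin n) → PrimRecV n (λ xs → lookup xs i)
pr-var i = P i , λ _ → refl

pr-[] : ∀ {n} → PrimRecVs n 0 (λ _ → [])
pr-[] = [] , λ _ → refl

pr-∷ : ∀ {n m f fs} → PrimRecV n f → PrimRecVs n m fs → PrimRecVs n (suc m) (λ xs → f xs ∷ fs xs)
pr-∷ (p , e) (ps , es) = p ∷ ps , λ xs → cong₂ _∷_ (e xs) (es xs)

pr-comp : ∀ {n m f gs} → PrimRecV m f → PrimRecVs n m gs → PrimRecV n (λ xs → f (gs xs))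
pr-comp (p , e) (ps , es) = comp p ps , λ xs → trans (cong (eval p) (es xs)) (e _)

natRec : ℕ → (ℕ → ℕ → ℕ) → ℕ → ℕ
natRec z s zero = z
natRec z s (suc y) = s y (natRec z s y)

pr-rec : ∀ {n g h} → PrimRecV n g → PrimRecV (suc (suc n)) h →
         PrimRecV (suc n) (λ xs → natRec (g (tail xs)) (λ y r → h (r ∷ y ∷ tail xs)) (head xs))
pr-rec {g = g} {h} (pg , eg) (ph , eh) = rec pg ph , λ { (y ∷ xs) → evalRec≡natRec y xs }
  where
  evalRec≡natRec : ∀ y xs → evalRec pg ph y xs ≡ natRec (g xs) (λ y r → h (r ∷ y ∷ xs)) y
  evalRec≡natRec zero xs = eg xs
  evalRec≡natRec (suc y) xs = trans (cong (λ r → eval ph (r ∷ y ∷ xs)) (evalRec≡natRec y xs)) (eh _)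

app₁ : ∀ {n f g} → PrimRec₁ f → PrimRecV n g → PrimRecV n (λ xs → f (g xs))
app₁ {f = f} (p , e) g = pr-comp {f = λ { (x ∷ []) → f x }} (p , λ { (x ∷ []) → e x }) (pr-∷ g pr-[])

app₂ : ∀ {n f g h} → PrimRec₂ f → PrimRecV n g → PrimRecV n h → PrimRecV n (λ xs → f (g xs) (h xs))
app₂ {f = f} (p , e) g h =
  pr-comp {f = λ { (x ∷ y ∷ []) → f x y }} (p , λ { (x ∷ y ∷ []) → e x y }) (pr-∷ g (pr-∷ h pr-[]))

app₃ : ∀ {n f g h k} → PrimRec₃ f → PrimRecV n g → PrimRecV n h → PrimRecV n k →
       PrimRecV n (λ xs → f (g xs) (h xs) (k xs))
app₃ {f = f} (p , e) g h k =
  pr-comp {f = λ { (x ∷ y ∷ z ∷ []) → f x y z }} (p , λ { (x ∷ y ∷ z ∷ []) → e x y z })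
          (pr-∷ g (pr-∷ h (pr-∷ k pr-[])))

app₄ : ∀ {n f g h k l} → PrimRec₄ f → PrimRecV n g → PrimRecV n h → PrimRecV n k → PrimRecV n l →
       PrimRecV n (λ xs → f (g xs) (h xs) (k xs) (l xs))
app₄ {f = f} (p , e) g h k l =
  pr-comp {f = λ { (x ∷ y ∷ z ∷ u ∷ []) → f x y z u }} (p , λ { (x ∷ y ∷ z ∷ u ∷ []) → e x y z u })
          (pr-∷ g (pr-∷ h (pr-∷ k (pr-∷ l pr-[]))))

app₅ : ∀ {n f g h k l o} → PrimRec₅ f → PrimRecV n g → PrimRecV n h → PrimRecV n k → PrimRecV n l → PrimRecV n o →
       PrimRecV n (λ xs → f (g xs) (h xs) (k xs) (l xs) (o xs))
app₅ {f = f} (p , e) g h k l o =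
  pr-comp {f = λ { (x ∷ y ∷ z ∷ u ∷ v ∷ []) → f x y z u v }} (p , λ { (x ∷ y ∷ z ∷ u ∷ v ∷ []) → e x y z u v })
          (pr-∷ g (pr-∷ h (pr-∷ k (pr-∷ l (pr-∷ o pr-[])))))

var₀ : ∀ {n} → PrimRecV (suc n) (λ xs → lookup xs fzero)
var₀ = pr-var fzero

var₁ : ∀ {n} → PrimRecV (suc (suc n)) (λ xs → lookup xs (fsuc fzero))
var₁ = pr-var (fsuc fzero)

var₂ : ∀ {n} → PrimRecV (3 + n) (λ xs → lookup xs (fsuc (fsuc fzero)))
var₂ = pr-var (fsuc (fsuc fzero))

var₃ : ∀ {n} → PrimRecV (4 + n) (λ xs → lookup xs (fsuc (fsuc (fsuc fzero))))
var₃ = pr-var (fsuc (fsuc (fsuc fzero)))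

var₄ : ∀ {n} → PrimRecV (5 + n) (λ xs → lookup xs (fsuc (fsuc (fsuc (fsuc fzero)))))
var₄ = pr-var (fsuc (fsuc (fsuc (fsuc fzero))))

pr-suc : ∀ {n f} → PrimRecV n f → PrimRecV n (λ xs → suc (f xs))
pr-suc = app₁ (S , λ _ → refl)

pr-const : ∀ {n} k → PrimRecV n (λ _ → k)
pr-const zero = pr-zero
pr-const (suc k) = pr-suc (pr-const k)

pr-+ : PrimRec₂ _+_
pr-+ = pr-ext₂ natRec-suc≡+ (pr-rec var₀ (pr-suc var₀))
  where
  natRec-suc≡+ : ∀ y x → natRec x (λ _ r → suc r) y ≡ y + x
  natRec-suc≡+ zero x = refl
  natRec-suc≡+ (suc y) x = cong suc (natRec-suc≡+ y x)

pr-* : PrimRec₂ _*_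
pr-* = pr-ext₂ natRec-+≡* (pr-rec pr-zero (app₂ pr-+ var₂ var₀))
  where
  natRec-+≡* : ∀ y x → natRec 0 (λ _ r → x + r) y ≡ y * x
  natRec-+≡* zero x = refl
  natRec-+≡* (suc y) x = cong (x +_) (natRec-+≡* y x)

pr-pred : PrimRec₁ pred
pr-pred = pr-ext₁ (λ { zero → refl ; (suc y) → refl }) (pr-rec {g = λ _ → 0} pr-zero var₁)

pr-∸ : PrimRec₂ _∸_
pr-∸ = pr-ext₂ (λ x y → natRec-pred≡∸ y x) (app₂ pr-iterPred var₁ var₀)
  where
  pr-iterPred : PrimRec₂ (λ y x → natRec x (λ _ r → pred r) y)
  pr-iterPred = curry₂ (pr-rec var₀ (app₁ pr-pred var₀))
  natRec-pred≡∸ : ∀ y x → natRec x (λ _ r → pred r) y ≡ x ∸ y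
  natRec-pred≡∸ zero x = refl
  natRec-pred≡∸ (suc y) x = trans (cong pred (natRec-pred≡∸ y x)) (pred[m∸n]≡m∸[1+n] x y)

pr-⊓ : PrimRec₂ _⊓_
pr-⊓ = pr-ext₂ n∸[n∸m]≡m⊓n (app₂ pr-∸ var₁ (app₂ pr-∸ var₁ var₀))
  where
  n∸[n∸m]≡m⊓n : ∀ m n → n ∸ (n ∸ m) ≡ m ⊓ n
  n∸[n∸m]≡m⊓n m n = trans (cong (_∸ (n ∸ m)) (sym (m⊓n+n∸m≡n m n))) (m+n∸n≡m (m ⊓ n) (n ∸ m))

ifz : {A : Set} → ℕ → A → A → A
ifz zero a b = a
ifz (suc _) a b = b

ifz-0 : ∀ {A : Set} {c} {x y : A} → c ≡ 0 → ifz c x y ≡ x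
ifz-0 refl = refl

ifz-1 : ∀ {A : Set} {c} {x y : A} → c ≡ 1 → ifz c x y ≡ y
ifz-1 refl = refl

ifz-map : ∀ {A B : Set} (f : A → B) c x y → f (ifz c x y) ≡ ifz c (f x) (f y)
ifz-map f zero x y = refl
ifz-map f (suc c) x y = refl

pr-ifz : PrimRec₃ ifz
pr-ifz = pr-ext₃ (λ { zero a b → refl ; (suc c) a b → refl }) (pr-rec var₀ var₃)

Indicates : ℕ → Set → Set
Indicates b A = (b ≡ 1 × A) ⊎ (b ≡ 0 × ¬ A)

χ< : ℕ → ℕ → ℕ
χ< a b = ifz (suc a ∸ b) 1 0

pr-χ< : PrimRec₂ χ<
pr-χ< = curry₂ (app₃ pr-ifz (app₂ pr-∸ (pr-suc var₀) var₁) (pr-const 1) (pr-const 0))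

χ<≡1 : ∀ {a b} → a < b → χ< a b ≡ 1
χ<≡1 a<b rewrite m≤n⇒m∸n≡0 a<b = refl

χ<≡0 : ∀ {a b} → b ≤ a → χ< a b ≡ 0
χ<≡0 {a} b≤a rewrite +-∸-assoc 1 b≤a = refl

χ<-indicates : ∀ a b → Indicates (χ< a b) (a < b)
χ<-indicates a b with <-≤-connex a b
... | inj₁ a<b = inj₁ (χ<≡1 a<b , a<b)
... | inj₂ b≤a = inj₂ (χ<≡0 b≤a , ≤⇒≯ b≤a)

Indicates-× : ∀ {x y A B} → Indicates x A → Indicates y B → Indicates (x * y) (A × B)
Indicates-× (inj₁ (refl , a)) (inj₁ (refl , b)) = inj₁ (refl , (a , b))
Indicates-× (inj₁ (refl , _)) (inj₂ (refl , ¬b)) = inj₂ (refl , λ ab → ¬b (proj₂ ab))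
Indicates-× (inj₂ (refl , ¬a)) _ = inj₂ (refl , λ ab → ¬a (proj₁ ab))

indicates-holds : ∀ {b A} → Indicates b A → b ≢ 0 → A
indicates-holds (inj₁ (_ , a)) _ = a
indicates-holds (inj₂ (b≡0 , _)) b≢0 = ⊥-elim (b≢0 b≡0)

indicates-fails : ∀ {b A} → Indicates b A → b ≡ 0 → ¬ A
indicates-fails (inj₁ (refl , _)) ()
indicates-fails (inj₂ (_ , ¬a)) _ = ¬a

indicates-≡1 : ∀ {b A} → Indicates b A → A → b ≡ 1
indicates-≡1 (inj₁ (b≡1 , _)) _ = b≡1
indicates-≡1 (inj₂ (_ , ¬a)) a = ⊥-elim (¬a a)

indicates-≡0 : ∀ {b A} → Indicates b A → ¬ A → b ≡ 0
indicates-≡0 (inj₁ (_ , a)) ¬a = ⊥-elim (¬a a)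
indicates-≡0 (inj₂ (b≡0 , _)) _ = b≡0

indicates-≤1 : ∀ {b A} → Indicates b A → b ≤ 1
indicates-≤1 (inj₁ (refl , _)) = ≤-refl
indicates-≤1 (inj₂ (refl , _)) = z≤n

pr-dropFirst : ∀ {n f} → PrimRecV n f → PrimRecV (suc n) (λ xs → f (tail xs))
pr-dropFirst {n} pf = pr-comp pf (tabulate (λ i → P (fsuc i)) , λ { (x ∷ xs) → trans (evalAll-P xs fsuc) (tabulate∘lookup xs) })
  where
  evalAll-P : ∀ {m k} (xs : Vec ℕ k) (σ : Fin m → Fin (suc k)) {x} →
              evalAll (tabulate (λ i → P (σ i))) (x ∷ xs) ≡ tabulate (λ i → lookup (x ∷ xs) (σ i))
  evalAll-P {zero} xs σ = refl
  evalAll-P {suc m} xs σ {x} = cong (lookup (x ∷ xs) (σ fzero) ∷_) (evalAll-P xs (λ i → σ (fsuc i)))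

sumBelow : (ℕ → ℕ) → ℕ → ℕ
sumBelow f y = natRec 0 (λ i r → r + f i) y

pr-sumBelow : ∀ {n f} → PrimRecV (suc n) f → PrimRecV (suc n) (λ xs → sumBelow (λ i → f (i ∷ tail xs)) (head xs))
pr-sumBelow pf = pr-rec pr-zero (app₂ pr-+ var₀ (pr-dropFirst pf))

sumBelow-cong : ∀ {f f′} → (∀ i → f i ≡ f′ i) → ∀ y → sumBelow f y ≡ sumBelow f′ y
sumBelow-cong f≗f′ zero = refl
sumBelow-cong f≗f′ (suc y) = cong₂ _+_ (sumBelow-cong f≗f′ y) (f≗f′ y)

μStep : (ℕ → ℕ) → ℕ → ℕ → ℕ
μStep p i r = ifz (χ< r i) (ifz (p i) (suc i) i) r

μBelow : (ℕ → ℕ) → ℕ → ℕ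
μBelow p y = natRec 0 (μStep p) y

pr-μBelow : ∀ {n f} → PrimRecV (suc n) f → PrimRecV (suc n) (λ xs → μBelow (λ i → f (i ∷ tail xs)) (head xs))
pr-μBelow pf =
  pr-rec pr-zero (app₃ pr-ifz (app₂ pr-χ< var₀ var₁) (app₃ pr-ifz (pr-dropFirst pf) (pr-suc var₁) var₁) var₀)

record IsLeastBelow (p : ℕ → ℕ) (y k : ℕ) : Set where
  field
    bound : k ≤ y
    below : ∀ i → i < k → p i ≡ 0
    found : k < y → p k ≢ 0

open IsLeastBelow

μStep-isLeast : ∀ {p y r} → IsLeastBelow p y r → IsLeastBelow p (suc y) (μStep p y r)
μStep-isLeast {p} {y} {r} least with m≤n⇒m<n∨m≡n (bound least)
... | inj₁ r<y rewrite χ<≡1 r<y =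
  record { bound = m≤n⇒m≤1+n (bound least) ; below = below least ; found = λ _ → found least r<y }
... | inj₂ refl rewrite χ<≡0 (≤-refl {r}) with p r in pr≡
...   | zero = record { bound = ≤-refl ; below = below-suc ; found = λ r<r → ⊥-elim (n≮n _ r<r) }
  where
  below-suc : ∀ i → i < suc r → p i ≡ 0
  below-suc i i<1+r with m≤n⇒m<n∨m≡n (≤-pred i<1+r)
  ... | inj₁ i<r = below least i i<r
  ... | inj₂ refl = pr≡
...   | suc _ = record { bound = n≤1+n r ; below = below least ; found = λ _ pr≡0 → 0≢1+n (trans (sym pr≡0) pr≡) }

μBelow-isLeast : ∀ p y → IsLeastBelow p y (μBelow p y)
μBelow-isLeast p zero = record { bound = z≤n ; below = λ _ () ; found = λ () }
μBelow-isLeast p (suc y) = μStep-isLeast (μBelow-isLeast p y)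

isLeastBelow-unique : ∀ {p y k k′} → IsLeastBelow p y k → IsLeastBelow p y k′ → k ≡ k′
isLeastBelow-unique {k = k} {k′} least least′ with <-cmp k k′
... | tri≈ _ k≡k′ _ = k≡k′
... | tri< k<k′ _ _ = ⊥-elim (found least (<-≤-trans k<k′ (bound least′)) (below least′ k k<k′))
... | tri> _ _ k′<k = ⊥-elim (found least′ (<-≤-trans k′<k (bound least)) (below least k′ k′<k))

-- Cantor pairing and codes of lists

triangle : ℕ → ℕ
triangle s = natRec 0 (λ i r → r + suc i) s

pr-triangle : PrimRec₁ triangle
pr-triangle = curry₁ (pr-rec pr-zero (app₂ pr-+ var₀ (pr-suc var₁)))

triangle-mono-≤ : ∀ {a b} → a ≤ b → triangle a ≤ triangle b
triangle-mono-≤ = stepwise-mono-≤ triangle (λ s → m≤m+n (triangle s) (suc s))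

n≤triangle : ∀ n → n ≤ triangle n
n≤triangle zero = z≤n
n≤triangle (suc n) = m≤n+m (suc n) (triangle n)

pair : ℕ → ℕ → ℕ
pair a b = triangle (a + b) + b

pr-pair : PrimRec₂ pair
pr-pair = curry₂ (app₂ pr-+ (app₁ pr-triangle (app₂ pr-+ var₀ var₁)) var₁)

diagonal : ℕ → ℕ
diagonal z = μBelow (λ s → χ< z (triangle (suc s))) (suc z)

pr-diagonal : PrimRec₁ diagonal
pr-diagonal = curry₁ (app₂ pr-search (pr-suc var₀) var₀)
  where
  pr-search : PrimRec₂ (λ y z → μBelow (λ s → χ< z (triangle (suc s))) y)
  pr-search = curry₂ (pr-μBelow (app₂ pr-χ< var₁ (app₁ pr-triangle (pr-suc var₀))))

unpair₂ : ℕ → ℕ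
unpair₂ z = z ∸ triangle (diagonal z)

unpair₁ : ℕ → ℕ
unpair₁ z = diagonal z ∸ unpair₂ z

pr-unpair₂ : PrimRec₁ unpair₂
pr-unpair₂ = curry₁ (app₂ pr-∸ var₀ (app₁ pr-triangle (app₁ pr-diagonal var₀)))

pr-unpair₁ : PrimRec₁ unpair₁
pr-unpair₁ = curry₁ (app₂ pr-∸ (app₁ pr-diagonal var₀) (app₁ pr-unpair₂ var₀))

diagonal-pair : ∀ a b → diagonal (pair a b) ≡ a + b
diagonal-pair a b = isLeastBelow-unique (μBelow-isLeast _ (suc (pair a b))) (record
  { bound = ≤-trans (n≤triangle (a + b)) (≤-trans (m≤m+n _ b) (n≤1+n _))
  ; below = λ i i<a+b → χ<≡0 (≤-trans (triangle-mono-≤ i<a+b) (m≤m+n _ b))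
  ; found = λ _ → subst (_≢ 0) (sym (χ<≡1 (+-monoʳ-< (triangle (a + b)) (s≤s (m≤n+m b a))))) (λ ()) })

unpair₂-pair : ∀ a b → unpair₂ (pair a b) ≡ b
unpair₂-pair a b rewrite diagonal-pair a b = m+n∸m≡n (triangle (a + b)) b

unpair₁-pair : ∀ a b → unpair₁ (pair a b) ≡ a
unpair₁-pair a b rewrite unpair₂-pair a b | diagonal-pair a b = m+n∸n≡m a b

pair-surjective : ∀ z → ∃₂ λ a b → pair a b ≡ z
pair-surjective zero = 0 , 0 , refl
pair-surjective (suc z) with pair-surjective z
... | zero , b , refl = suc b , 0 , trans (+-identityʳ _) (trans (cong triangle (+-identityʳ (suc b))) (+-suc (triangle b) b))
... | suc a , b , refl = a , suc b , trans (cong (λ s → triangle s + suc b) (+-suc a b)) (+-suc _ b)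

pair-unpair : ∀ z → pair (unpair₁ z) (unpair₂ z) ≡ z
pair-unpair z with pair-surjective z
... | a , b , refl rewrite unpair₁-pair a b | unpair₂-pair a b = refl

cons : ℕ → ℕ → ℕ
cons a u = suc (pair a u)

hd : ℕ → ℕ
hd u = unpair₁ (pred u)

tl : ℕ → ℕ
tl u = unpair₂ (pred u)

pr-cons : PrimRec₂ cons
pr-cons = curry₂ (pr-suc (app₂ pr-pair var₀ var₁))

pr-hd : PrimRec₁ hd
pr-hd = curry₁ (app₁ pr-unpair₁ (app₁ pr-pred var₀))

pr-tl : PrimRec₁ tl
pr-tl = curry₁ (app₁ pr-unpair₂ (app₁ pr-pred var₀))

hd-cons : ∀ a u → hd (cons a u) ≡ a
hd-cons = unpair₁-pair

tl-cons : ∀ a u → tl (cons a u) ≡ u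
tl-cons = unpair₂-pair

cons-hd-tl : ∀ u → cons (hd (suc u)) (tl (suc u)) ≡ suc u
cons-hd-tl u = cong suc (pair-unpair u)

tl<suc : ∀ u → tl (suc u) < suc u
tl<suc u = s≤s (m∸n≤m u (triangle (diagonal u)))

<cons : ∀ a u → u < cons a u
<cons a u = s≤s (m≤n+m u (triangle (a + u)))

head<cons : ∀ a u → a < cons a u
head<cons a u = s≤s (≤-trans (m≤m+n a u) (≤-trans (n≤triangle (a + u)) (m≤m+n _ u)))

⌜_⌝ : List ℕ → ℕ
⌜ [] ⌝ = 0
⌜ a ∷ l ⌝ = cons a ⌜ l ⌝

length≤code : ∀ l → length l ≤ ⌜ l ⌝
length≤code [] = z≤n
length≤code (a ∷ l) = ≤-trans (s≤s (length≤code l)) (<cons a ⌜ l ⌝)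

code-injective : ∀ {l l′} → ⌜ l ⌝ ≡ ⌜ l′ ⌝ → l ≡ l′
code-injective {[]} {[]} _ = refl
code-injective {a ∷ l} {b ∷ l′} e =
  cong₂ _∷_ (trans (sym (hd-cons a ⌜ l ⌝)) (trans (cong hd e) (hd-cons b ⌜ l′ ⌝)))
            (code-injective (trans (sym (tl-cons a ⌜ l ⌝)) (trans (cong tl e) (tl-cons b ⌜ l′ ⌝))))

decodeWithin : ℕ → ℕ → List ℕ
decodeWithin zero u = []
decodeWithin (suc k) zero = []
decodeWithin (suc k) (suc u) = hd (suc u) ∷ decodeWithin k (tl (suc u))

decode : ℕ → List ℕ
decode u = decodeWithin u u

code-decodeWithin : ∀ k u → u ≤ k → ⌜ decodeWithin k u ⌝ ≡ u
code-decodeWithin zero .zero z≤n = refl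
code-decodeWithin (suc k) zero _ = refl
code-decodeWithin (suc k) (suc u) (s≤s u≤k)
  rewrite code-decodeWithin k (tl (suc u)) (≤-pred (≤-trans (tl<suc u) (s≤s u≤k))) = cons-hd-tl u

code-decode : ∀ u → ⌜ decode u ⌝ ≡ u
code-decode u = code-decodeWithin u u ≤-refl

decode-code : ∀ l → decode ⌜ l ⌝ ≡ l
decode-code l = code-injective (code-decode ⌜ l ⌝)

dropCode : ℕ → ℕ → ℕ
dropCode k u = natRec u (λ _ r → tl r) k

pr-dropCode : PrimRec₂ dropCode
pr-dropCode = curry₂ (pr-rec var₀ (app₁ pr-tl var₀))

dropCode-code : ∀ k l → dropCode k ⌜ l ⌝ ≡ ⌜ drop k l ⌝
dropCode-code zero l = refl
dropCode-code (suc k) l rewrite dropCode-code k l = tl-drop k l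
  where
  tl-drop : ∀ k l → tl ⌜ drop k l ⌝ ≡ ⌜ drop (suc k) l ⌝
  tl-drop zero [] = refl
  tl-drop zero (a ∷ l) = tl-cons a ⌜ l ⌝
  tl-drop (suc k) [] = refl
  tl-drop (suc k) (a ∷ l) = tl-drop k l

drop-suc-∷ : ∀ k (l : List ℕ) {a l′} → drop k l ≡ a ∷ l′ → drop (suc k) l ≡ l′
drop-suc-∷ zero (b ∷ l) refl = refl
drop-suc-∷ (suc k) (b ∷ l) e = drop-suc-∷ k l e

module CodeRecursion (Z : ℕ → ℕ → ℕ) (H : ℕ → ℕ → ℕ → ℕ → ℕ → ℕ) where

  listRec : ℕ → List ℕ → ℕ → ℕ
  listRec j [] v = Z j v
  listRec j (a ∷ l) v = H j a ⌜ l ⌝ v (listRec (suc j) l (tl v))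

  -- Stage i treats the suffix of the list coded by u that starts at position u ∸ suc i,
  -- so the suffixes are processed from the (empty) end towards the front.
  stageAt : ℕ → ℕ → ℕ → ℕ → ℕ → ℕ
  stageAt j k s w r = ifz s (Z (j + k) w) (H (j + k) (hd s) (tl s) w r)

  stages : ℕ → ℕ → ℕ → ℕ → ℕ
  stages i j u v =
    natRec (Z (j + u) (dropCode u v)) (λ i r → stageAt j (u ∸ suc i) (dropCode (u ∸ suc i) u) (dropCode (u ∸ suc i) v) r) i

  stages-code : ∀ j l v i → i ≤ ⌜ l ⌝ →
                stages i j ⌜ l ⌝ v ≡ listRec (j + (⌜ l ⌝ ∸ i)) (drop (⌜ l ⌝ ∸ i) l) (dropCode (⌜ l ⌝ ∸ i) v)
  stages-code j l v zero _ rewrite drop-all ⌜ l ⌝ l (length≤code l) = refl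
  stages-code j l v (suc i) i<u rewrite stages-code j l v i (<⇒≤ i<u) | +-∸-assoc 1 i<u with ⌜ l ⌝ ∸ suc i
  ... | k rewrite dropCode-code k l with drop k l in dropₖ
  ...   | [] = refl
  ...   | a ∷ l′ rewrite hd-cons a ⌜ l′ ⌝ | tl-cons a ⌜ l′ ⌝ | drop-suc-∷ k l dropₖ | +-suc j k = refl

  pr-listRec : PrimRec₂ Z → PrimRec₅ H → PrimRec₃ (λ j u v → listRec j (decode u) v)
  pr-listRec pZ pH = pr-ext₃ listRec-decode (app₄ pr-stages var₁ var₀ var₁ var₂)
    where
    pr-stageAt : PrimRec₅ stageAt
    pr-stageAt = curry₅ (app₃ pr-ifz var₂
      (app₂ pZ (app₂ pr-+ var₀ var₁) var₃)
      (app₅ pH (app₂ pr-+ var₀ var₁) (app₁ pr-hd var₂) (app₁ pr-tl var₂) var₃ var₄))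
    pr-stages : PrimRec₄ stages
    pr-stages = curry₄ (pr-rec (app₂ pZ (app₂ pr-+ var₀ var₁) (app₂ pr-dropCode var₁ var₂))
                               (app₅ pr-stageAt var₂ (app₂ pr-∸ var₃ (pr-suc var₁))
                                                     (app₂ pr-dropCode (app₂ pr-∸ var₃ (pr-suc var₁)) var₃)
                                                     (app₂ pr-dropCode (app₂ pr-∸ var₃ (pr-suc var₁)) var₄) var₀))
    listRec-decode : ∀ j u v → stages u j u v ≡ listRec j (decode u) v
    listRec-decode j u v with decode u | code-decode u
    ... | l | refl rewrite stages-code j l v ⌜ l ⌝ ≤-refl | n∸n≡0 ⌜ l ⌝ | +-identityʳ j = refl

-- Ackermann's function bounds every primitive recursive function

ack : ℕ → ℕ → ℕ
ack zero n = suc n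
ack (suc m) zero = ack m 1
ack (suc m) (suc n) = ack m (ack (suc m) n)

n<ack : ∀ m n → n < ack m n
n<ack zero n = ≤-refl
n<ack (suc m) zero = <-trans z<s (n<ack m 1)
n<ack (suc m) (suc n) = ≤-<-trans (n<ack (suc m) n) (n<ack m (ack (suc m) n))

ack<ack-suc : ∀ m n → ack m n < ack m (suc n)
ack<ack-suc zero n = ≤-refl
ack<ack-suc (suc m) n = n<ack m (ack (suc m) n)

ack-monoʳ-< : ∀ m {n n′} → n < n′ → ack m n < ack m n′
ack-monoʳ-< m = stepwise-mono-< (ack m) (ack<ack-suc m)

ack-monoʳ-≤ : ∀ m {n n′} → n ≤ n′ → ack m n ≤ ack m n′
ack-monoʳ-≤ m = stepwise-mono-≤ (ack m) (λ n → <⇒≤ (ack<ack-suc m n))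

ack-suc≤ack-suc : ∀ m n → ack m (suc n) ≤ ack (suc m) n
ack-suc≤ack-suc m zero = ≤-refl
ack-suc≤ack-suc m (suc n) = ack-monoʳ-≤ m (≤-trans (n<ack m (suc n)) (ack-suc≤ack-suc m n))

ack-monoˡ-< : ∀ {m m′} n → m < m′ → ack m n < ack m′ n
ack-monoˡ-< n = stepwise-mono-< (λ m → ack m n) (λ m → <-≤-trans (ack<ack-suc m n) (ack-suc≤ack-suc m n))

ack-monoˡ-≤ : ∀ {m m′} n → m ≤ m′ → ack m n ≤ ack m′ n
ack-monoˡ-≤ n = stepwise-mono-≤ (λ m → ack m n) (λ m → <⇒≤ (ack-monoˡ-< n (n<1+n m)))

ack-mono-≤ : ∀ {m m′ n n′} → m ≤ m′ → n ≤ n′ → ack m n ≤ ack m′ n′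
ack-mono-≤ {m′ = m′} {n} m≤m′ n≤n′ = ≤-trans (ack-monoˡ-≤ n m≤m′) (ack-monoʳ-≤ m′ n≤n′)

ack-twice : ∀ m n → ack m (ack m n) < ack (suc (suc m)) n
ack-twice m n = <-≤-trans (ack-monoʳ-< m (ack-monoˡ-< n (n<1+n m))) (ack-suc≤ack-suc (suc m) n)

ack-comp : ∀ a b n → ack a (ack b n) < ack (suc (suc (a ⊔ b))) n
ack-comp a b n = ≤-<-trans (ack-mono-≤ (m≤m⊔n a b) (ack-monoˡ-≤ n (m≤n⊔m a b))) (ack-twice (a ⊔ b) n)

ack-1 : ∀ n → ack 1 n ≡ suc (suc n)
ack-1 zero = refl
ack-1 (suc n) = cong suc (ack-1 n)

ack-2 : ∀ n → ack 2 n ≡ suc (suc (suc (n + n)))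
ack-2 zero = refl
ack-2 (suc n) rewrite ack-1 (ack 2 n) | ack-2 n | +-suc n n = refl

+<ack-2 : ∀ a b → a + b < ack 2 (a ⊔ b)
+<ack-2 a b rewrite ack-2 (a ⊔ b) = ≤-trans (s≤s (+-mono-≤ (m≤m⊔n a b) (m≤n⊔m a b))) (≤-trans (n≤1+n _) (n≤1+n _))

max : ∀ {n} → Vec ℕ n → ℕ
max [] = 0
max (x ∷ xs) = x ⊔ max xs

lookup≤max : ∀ {n} (xs : Vec ℕ n) i → lookup xs i ≤ max xs
lookup≤max (x ∷ xs) fzero = m≤m⊔n x (max xs)
lookup≤max (x ∷ xs) (fsuc i) = ≤-trans (lookup≤max xs i) (m≤n⊔m x (max xs))

AckBounded : ∀ {n} → ℕ → (Vec ℕ n → ℕ) → Set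
AckBounded k f = ∀ xs → f xs < ack k (max xs)

evalRec-bound : ∀ {n} {g : PR n} {h} kg kh → AckBounded kg (eval g) → AckBounded kh (eval h) →
                ∀ y xs → evalRec g h y xs < ack (suc (kg ⊔ kh)) (y + max xs)
evalRec-bound kg kh bg bh zero xs =
  <-≤-trans (bg xs) (ack-monoˡ-≤ (max xs) (≤-trans (m≤m⊔n kg kh) (n≤1+n _)))
evalRec-bound {g = g} {h} kg kh bg bh (suc y) xs =
  <-≤-trans (bh (r ∷ y ∷ xs))
            (ack-mono-≤ (m≤n⊔m kg kh) (<⇒≤ (⊔-pres-<m (evalRec-bound kg kh bg bh y xs) (⊔-pres-<m y<B max<B))))
  where
  r : ℕ
  r = evalRec g h y xs
  y<B : y < ack (suc (kg ⊔ kh)) (y + max xs)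
  y<B = ≤-<-trans (m≤m+n y (max xs)) (n<ack (suc (kg ⊔ kh)) (y + max xs))
  max<B : max xs < ack (suc (kg ⊔ kh)) (y + max xs)
  max<B = ≤-<-trans (m≤n+m (max xs) y) (n<ack (suc (kg ⊔ kh)) (y + max xs))

mutual
  ack-bounds-eval : ∀ {n} (p : PR n) → ∃ λ k → AckBounded k (eval p)
  ack-bounds-eval Z = 0 , λ _ → z<s
  ack-bounds-eval S = 1 , λ { (x ∷ []) →
    subst (suc x <_) (sym (trans (ack-1 (x ⊔ 0)) (cong (λ t → suc (suc t)) (⊔-identityʳ x)))) ≤-refl }
  ack-bounds-eval (P i) = 0 , λ xs → s≤s (lookup≤max xs i)
  ack-bounds-eval (comp f gs) with ack-bounds-eval f | ack-bounds-evalAll gs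
  ... | kf , bf | kg , bg = suc (suc (kf ⊔ kg)) , λ xs →
    <-trans (<-≤-trans (bf (evalAll gs xs)) (ack-monoʳ-≤ kf (<⇒≤ (bg xs)))) (ack-comp kf kg (max xs))
  ack-bounds-eval (rec g h) with ack-bounds-eval g | ack-bounds-eval h
  ... | kg , bg | kh , bh = suc (suc (suc (kg ⊔ kh) ⊔ 2)) , λ { (y ∷ xs) →
    <-trans (<-≤-trans (evalRec-bound kg kh bg bh y xs) (ack-monoʳ-≤ (suc (kg ⊔ kh)) (<⇒≤ (+<ack-2 y (max xs)))))
            (ack-comp (suc (kg ⊔ kh)) 2 (y ⊔ max xs)) }

  ack-bounds-evalAll : ∀ {n m} (ps : Vec (PR n) m) → ∃ λ k → ∀ xs → max (evalAll ps xs) < ack k (max xs)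
  ack-bounds-evalAll [] = 0 , λ _ → z<s
  ack-bounds-evalAll (p ∷ ps) with ack-bounds-eval p | ack-bounds-evalAll ps
  ... | k₁ , b₁ | k₂ , b₂ = k₁ ⊔ k₂ , λ xs →
    ⊔-pres-<m (<-≤-trans (b₁ xs) (ack-monoˡ-≤ _ (m≤m⊔n k₁ k₂)))
              (<-≤-trans (b₂ xs) (ack-monoˡ-≤ _ (m≤n⊔m k₁ k₂)))

ack-dominates : ∀ {f} → PrimRec₁ f → ∃ λ k → ∀ x → f x < ack k x
ack-dominates {f} (p , e) with ack-bounds-eval p
... | k , b = k , λ x → subst₂ _<_ (e x) (cong (ack k) (⊔-identityʳ x)) (b (x ∷ []))

-- A clocked stack machine for Ackermann's function, and the radices

-- The top of the stack is the head of the list.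
machineStep : List ℕ → List ℕ
machineStep [] = []
machineStep (n ∷ []) = n ∷ []
machineStep (n ∷ zero ∷ s) = suc n ∷ s
machineStep (zero ∷ suc m ∷ s) = 1 ∷ m ∷ s
machineStep (suc n ∷ suc m ∷ s) = n ∷ suc m ∷ m ∷ s

run : ℕ → List ℕ → List ℕ
run zero l = l
run (suc s) l = run s (machineStep l)

run-+ : ∀ s t l → run (s + t) l ≡ run t (run s l)
run-+ zero t l = refl
run-+ (suc s) t l = run-+ s t (machineStep l)

run-suc : ∀ s l → run (suc s) l ≡ machineStep (run s l)
run-suc zero l = refl
run-suc (suc s) l = run-suc s (machineStep l)

run-halted : ∀ s x → run s (x ∷ []) ≡ x ∷ []
run-halted zero x = refl
run-halted (suc s) x = run-halted s x

steps : ℕ → ℕ → ℕ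
steps zero n = 1
steps (suc m) zero = suc (steps m 1)
steps (suc m) (suc n) = suc (steps (suc m) n + steps m (ack (suc m) n))

run-steps : ∀ m n s → run (steps m n) (n ∷ m ∷ s) ≡ ack m n ∷ s
run-steps zero n s = refl
run-steps (suc m) zero s = run-steps m 1 s
run-steps (suc m) (suc n) s = begin
  run (steps (suc m) n + steps m (ack (suc m) n)) (n ∷ suc m ∷ m ∷ s)
    ≡⟨ run-+ (steps (suc m) n) _ _ ⟩
  run (steps m (ack (suc m) n)) (run (steps (suc m) n) (n ∷ suc m ∷ m ∷ s))
    ≡⟨ cong (run (steps m (ack (suc m) n))) (run-steps (suc m) n (m ∷ s)) ⟩
  run (steps m (ack (suc m) n)) (ack (suc m) n ∷ m ∷ s)
    ≡⟨ run-steps m (ack (suc m) n) s ⟩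
  ack (suc m) (suc n) ∷ s ∎
  where open ≡-Reasoning

run-split : ∀ {k t} l → k ≤ t → run t l ≡ run (t ∸ k) (run k l)
run-split {k} {t} l k≤t = trans (cong (λ t → run t l) (sym (m+[n∸m]≡n k≤t))) (run-+ k (t ∸ k) l)

run-beyond-steps : ∀ m n t → steps m n ≤ t → run t (n ∷ m ∷ []) ≡ ack m n ∷ []
run-beyond-steps m n t steps≤t rewrite run-split (n ∷ m ∷ []) steps≤t | run-steps m n [] = run-halted (t ∸ steps m n) (ack m n)

Busy : List ℕ → Set
Busy l = ∃₂ λ a b → ∃ λ s → l ≡ a ∷ b ∷ s

run-before-steps : ∀ m n s t → t < steps m n → Busy (run t (n ∷ m ∷ s))
run-before-steps m n s zero _ = n , m , s , refl
run-before-steps zero n s (suc t) (s≤s ())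
run-before-steps (suc m) zero s (suc t) (s≤s t<) = run-before-steps m 1 s t t<
run-before-steps (suc m) (suc n) s (suc t) (s≤s t<) =
  [ run-before-steps (suc m) n (m ∷ s) t
  , (λ first≤t → subst Busy (sym (after-first first≤t))
                             (run-before-steps m (ack (suc m) n) s (t ∸ first) (second< first≤t))) ]′
  (<-≤-connex t first)
  where
  first : ℕ
  first = steps (suc m) n
  after-first : first ≤ t → run t (n ∷ suc m ∷ m ∷ s) ≡ run (t ∸ first) (ack (suc m) n ∷ m ∷ s)
  after-first first≤t = trans (run-split _ first≤t) (cong (run (t ∸ first)) (run-steps (suc m) n (m ∷ s)))
  second< : first ≤ t → t ∸ first < steps m (ack (suc m) n)
  second< first≤t = +-cancelˡ-< first _ _ (subst (_< _) (sym (m+[n∸m]≡n first≤t)) t<)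

ack≤steps+ : ∀ m n → ack m n ≤ steps m n + n
ack≤steps+ zero n = ≤-refl
ack≤steps+ (suc m) zero = ≤-trans (ack≤steps+ m 1) (≤-reflexive (+-suc (steps m 1) 0))
ack≤steps+ (suc m) (suc n) = begin
  ack m (ack (suc m) n)                       ≤⟨ ack≤steps+ m (ack (suc m) n) ⟩
  steps m (ack (suc m) n) + ack (suc m) n     ≤⟨ +-monoʳ-≤ (steps m (ack (suc m) n)) (ack≤steps+ (suc m) n) ⟩
  steps m (ack (suc m) n) + (steps (suc m) n + n)
    ≡⟨ trans (sym (+-assoc (steps m (ack (suc m) n)) _ n)) (cong (_+ n) (+-comm (steps m (ack (suc m) n)) _)) ⟩
  steps (suc m) n + steps m (ack (suc m) n) + n ≤⟨ +-mono-≤ (n≤1+n _) (n≤1+n n) ⟩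
  steps (suc m) (suc n) + suc n ∎
  where open ≤-Reasoning

busyStepCode : ℕ → ℕ → ℕ → ℕ
busyStepCode n m s =
  ifz m (cons (suc n) s) (ifz n (cons 1 (cons (pred m) s)) (cons (pred n) (cons m (cons (pred m) s))))

stepCode : ℕ → ℕ
stepCode u = ifz (tl u) u (busyStepCode (hd u) (hd (tl u)) (tl (tl u)))

pr-stepCode : PrimRec₁ stepCode
pr-stepCode = curry₁ (app₃ pr-ifz (app₁ pr-tl var₀) var₀
  (app₃ pr-busyStepCode (app₁ pr-hd var₀) (app₁ pr-hd (app₁ pr-tl var₀)) (app₁ pr-tl (app₁ pr-tl var₀))))
  where
  pr-busyStepCode : PrimRec₃ busyStepCode
  pr-busyStepCode = curry₃ (app₃ pr-ifz var₁ (app₂ pr-cons (pr-suc var₀) var₂)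
    (app₃ pr-ifz var₀ (app₂ pr-cons (pr-const 1) (app₂ pr-cons (app₁ pr-pred var₁) var₂))
                      (app₂ pr-cons (app₁ pr-pred var₀) (app₂ pr-cons var₁ (app₂ pr-cons (app₁ pr-pred var₁) var₂)))))

stepCode-cons : ∀ n t → stepCode (cons n t) ≡ ifz t (cons n t) (busyStepCode n (hd t) (tl t))
stepCode-cons n t = cong₂ (λ a t′ → ifz t′ (cons n t) (busyStepCode a (hd t′) (tl t′))) (hd-cons n t) (tl-cons n t)

busyStepCode-code : ∀ n m s → busyStepCode n m ⌜ s ⌝ ≡ ⌜ machineStep (n ∷ m ∷ s) ⌝
busyStepCode-code n zero s = refl
busyStepCode-code zero (suc m) s = refl
busyStepCode-code (suc n) (suc m) s = refl

stepCode-code : ∀ l → stepCode ⌜ l ⌝ ≡ ⌜ machineStep l ⌝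
stepCode-code [] = refl
stepCode-code (n ∷ []) = stepCode-cons n 0
stepCode-code (n ∷ m ∷ s) = trans (stepCode-cons n ⌜ m ∷ s ⌝)
  (trans (cong₂ (busyStepCode n) (hd-cons m ⌜ s ⌝) (tl-cons m ⌜ s ⌝)) (busyStepCode-code n m s))

runCode : ℕ → ℕ → ℕ
runCode t u = natRec u (λ _ r → stepCode r) t

runCode-code : ∀ t l → runCode t ⌜ l ⌝ ≡ ⌜ run t l ⌝
runCode-code zero l = refl
runCode-code (suc t) l = trans (cong stepCode (runCode-code t l)) (trans (stepCode-code (run t l)) (cong ⌜_⌝ (sym (run-suc t l))))

busyCode : ℕ → ℕ
busyCode u = ifz (tl u) 0 1

busyCode-run : ∀ m n t → busyCode (runCode t ⌜ n ∷ m ∷ [] ⌝) ≡ χ< t (steps m n)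
busyCode-run m n t rewrite runCode-code t (n ∷ m ∷ []) with <-≤-connex t (steps m n)
... | inj₂ steps≤t rewrite run-beyond-steps m n t steps≤t | tl-cons (ack m n) 0 = sym (χ<≡0 steps≤t)
... | inj₁ t<steps with run-before-steps m n [] t t<steps
...   | a , b , s , e rewrite e | tl-cons a ⌜ b ∷ s ⌝ = sym (χ<≡1 t<steps)

sumBelow-χ< : ∀ n y → sumBelow (λ s → χ< s n) y ≡ n ⊓ y
sumBelow-χ< n zero = sym (⊓-zeroʳ n)
sumBelow-χ< n (suc y) rewrite sumBelow-χ< n y with <-≤-connex y n
... | inj₁ y<n rewrite χ<≡1 y<n | m≥n⇒m⊓n≡n (<⇒≤ y<n) | m≥n⇒m⊓n≡n y<n = +-comm y 1
... | inj₂ n≤y rewrite χ<≡0 n≤y | m≤n⇒m⊓n≡m n≤y | m≤n⇒m⊓n≡m (m≤n⇒m≤1+n n≤y) = +-identityʳ n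

-- Simulates only t + 1 steps, however large steps m n is.
cappedSteps : ℕ → ℕ → ℕ → ℕ
cappedSteps m n t = sumBelow (λ s → busyCode (runCode s ⌜ n ∷ m ∷ [] ⌝)) (suc t)

pr-cappedSteps : PrimRec₃ cappedSteps
pr-cappedSteps = curry₃ (app₂ pr-count (pr-suc var₂) (app₂ pr-cons var₁ (app₂ pr-cons var₀ pr-zero)))
  where
  pr-count : PrimRec₂ (λ y u → sumBelow (λ s → busyCode (runCode s u)) y)
  pr-count = curry₂ (pr-sumBelow (app₃ pr-ifz (app₁ pr-tl (app₂ pr-runCode var₀ var₁)) (pr-const 0) (pr-const 1)))
    where
    pr-runCode : PrimRec₂ runCode
    pr-runCode = curry₂ (pr-rec var₀ (app₁ pr-stepCode var₀))

cappedSteps-spec : ∀ m n t → cappedSteps m n t ≡ steps m n ⊓ suc t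
cappedSteps-spec m n t = trans (sumBelow-cong (busyCode-run m n) (suc t)) (sumBelow-χ< (steps m n) (suc t))

-- The summand place j makes radix j ≥ place j, which cappedRadix-spec relies on.
place : ℕ → ℕ
place zero = 1
place (suc j) = place j * (steps j (place j) + place j + 2)

radix : ℕ → ℕ
radix j = steps j (place j) + place j + 2

2≤radix : ∀ j → 2 ≤ radix j
2≤radix j = m≤n+m 2 (steps j (place j) + place j)

0<place : ∀ j → 0 < place j
0<place zero = z<s
0<place (suc j) = *-mono-≤ (0<place j) (≤-trans (n≤1+n 1) (2≤radix j))

place-nonZero : ∀ j → NonZero (place j)
place-nonZero j = >-nonZero (0<place j)

place≤radix : ∀ j → place j ≤ radix j
place≤radix j = ≤-trans (m≤n+m (place j) (steps j (place j))) (m≤m+n _ 2)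

ack<radix : ∀ j → ack j (place j) < radix j
ack<radix j = ≤-trans (s≤s (ack≤steps+ j (place j))) (≤-trans (n≤1+n _) (≤-reflexive (+-comm 2 _)))

radix≤place-suc : ∀ j → radix j ≤ place (suc j)
radix≤place-suc j = m≤n*m (radix j) (place j) {{place-nonZero j}}

place<place-suc : ∀ j → place j < place (suc j)
place<place-suc j = m<m*n (place j) (radix j) {{place-nonZero j}} (2≤radix j)

place-mono-≤ : ∀ {i j} → i ≤ j → place i ≤ place j
place-mono-≤ = stepwise-mono-≤ place (λ j → <⇒≤ (place<place-suc j))

n<place : ∀ j → j < place j
n<place zero = ≤-refl
n<place (suc j) = <-≤-trans (s≤s (n<place j)) (place<place-suc j)

capped-inflationary : ∀ (h : ℕ → ℕ) → (∀ {x y} → x ≤ y → h x ≤ h y) → (∀ x → x ≤ h x) →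
                      ∀ x w → h (x ⊓ w) ⊓ w ≡ h x ⊓ w
capped-inflationary h mono infl x w with ≤-total x w
... | inj₁ x≤w rewrite m≤n⇒m⊓n≡m x≤w = refl
... | inj₂ w≤x rewrite m≥n⇒m⊓n≡n w≤x | m≥n⇒m⊓n≡n (infl w) | m≥n⇒m⊓n≡n (≤-trans w≤x (infl x)) = refl

capped-guard : ∀ {x y t} (F : ℕ → ℕ) → x ≤ y → (x ≤ t → F x ≡ y ⊓ suc t) →
               ifz (χ< t (x ⊓ suc t)) (F (x ⊓ suc t)) (suc t) ≡ y ⊓ suc t
capped-guard {x} {y} {t} F x≤y F-spec with <-≤-connex t x
... | inj₁ t<x rewrite m≥n⇒m⊓n≡n t<x | χ<≡1 (n<1+n t) | m≥n⇒m⊓n≡n (≤-trans t<x x≤y) = refl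
... | inj₂ x≤t rewrite m≤n⇒m⊓n≡m (m≤n⇒m≤1+n x≤t) | χ<≡0 x≤t = F-spec x≤t

cappedRadixFrom : ℕ → ℕ → ℕ → ℕ
cappedRadixFrom j q t = (cappedSteps j q t + q + 2) ⊓ suc t

cappedPlace : ℕ → ℕ → ℕ
cappedPlace j t = natRec 1 (λ i r → ifz (χ< t r) ((r * cappedRadixFrom i r t) ⊓ suc t) (suc t)) j

cappedRadixFrom-place : ∀ j t → cappedRadixFrom j (place j) t ≡ radix j ⊓ suc t
cappedRadixFrom-place j t =
  trans (cong (λ c → (c + place j + 2) ⊓ suc t) (cappedSteps-spec j (place j) t))
        (capped-inflationary (λ c → c + place j + 2) (λ c≤c′ → +-monoˡ-≤ 2 (+-monoˡ-≤ (place j) c≤c′))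
                             (λ c → ≤-trans (m≤m+n c (place j)) (m≤m+n _ 2)) (steps j (place j)) (suc t))

cappedPlace-spec : ∀ j t → cappedPlace j t ≡ place j ⊓ suc t
cappedPlace-spec zero t = refl
cappedPlace-spec (suc j) t =
  trans (cong (λ r → ifz (χ< t r) ((r * cappedRadixFrom j r t) ⊓ suc t) (suc t)) (cappedPlace-spec j t))
        (capped-guard (λ r → (r * cappedRadixFrom j r t) ⊓ suc t) (<⇒≤ (place<place-suc j)) (λ _ →
          trans (cong (λ r → (place j * r) ⊓ suc t) (cappedRadixFrom-place j t))
                (capped-inflationary (place j *_) (*-monoʳ-≤ (place j)) (λ x → m≤n*m x (place j) {{place-nonZero j}})
                                     (radix j) (suc t))))

-- Opaque, so that type checking never unfolds the clocked simulation.
opaque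
  cappedRadix : ℕ → ℕ → ℕ
  cappedRadix j t = ifz (χ< t (cappedPlace j t)) (cappedRadixFrom j (cappedPlace j t) t) (suc t)

  pr-cappedRadix : PrimRec₂ cappedRadix
  pr-cappedRadix = curry₂ (app₃ pr-ifz (app₂ pr-χ< var₁ (app₂ pr-cappedPlace var₀ var₁))
                                       (app₃ pr-cappedRadixFrom var₀ (app₂ pr-cappedPlace var₀ var₁) var₁) (pr-suc var₁))
    where
    pr-cappedRadixFrom : PrimRec₃ cappedRadixFrom
    pr-cappedRadixFrom =
      curry₃ (app₂ pr-⊓ (app₂ pr-+ (app₂ pr-+ (app₃ pr-cappedSteps var₀ var₁ var₂) var₁) (pr-const 2)) (pr-suc var₂))
    pr-cappedPlace : PrimRec₂ cappedPlace
    pr-cappedPlace = curry₂ (pr-rec (pr-const 1)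
      (app₃ pr-ifz (app₂ pr-χ< var₂ var₀)
                   (app₂ pr-⊓ (app₂ pr-* var₀ (app₃ pr-cappedRadixFrom var₁ var₀ var₂)) (pr-suc var₂))
                   (pr-suc var₂)))

  cappedRadix-spec : ∀ j t → cappedRadix j t ≡ radix j ⊓ suc t
  cappedRadix-spec j t =
    trans (cong (λ r → ifz (χ< t r) (cappedRadixFrom j r t) (suc t)) (cappedPlace-spec j t))
          (capped-guard (λ r → cappedRadixFrom j r t) (place≤radix j) (λ _ → cappedRadixFrom-place j t))

χ<-capped : ∀ a x → χ< a (x ⊓ suc a) ≡ χ< a x
χ<-capped a x with ≤-total x (suc a)
... | inj₁ x≤1+a rewrite m≤n⇒m⊓n≡m x≤1+a = refl
... | inj₂ 1+a≤x rewrite m≥n⇒m⊓n≡n 1+a≤x | χ<≡1 (n<1+n a) | χ<≡1 1+a≤x = refl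

χ<radix : ℕ → ℕ → ℕ
χ<radix j a = χ< a (cappedRadix j a)

pr-χ<radix : PrimRec₂ χ<radix
pr-χ<radix = curry₂ (app₂ pr-χ< var₁ (app₂ pr-cappedRadix var₀ var₁))

χ<radix-spec : ∀ j a → χ<radix j a ≡ χ< a (radix j)
χ<radix-spec j a = trans (cong (χ< a) (cappedRadix-spec j a)) (χ<-capped a (radix j))

cappedRadix-≥ : ∀ {j t} → radix j ≤ t → cappedRadix j t ≡ radix j
cappedRadix-≥ {j} {t} radix≤t = trans (cappedRadix-spec j t) (m≤n⇒m⊓n≡m (m≤n⇒m≤1+n radix≤t))

-- Mixed-radix numerals and their arithmetic on codes

-- Little-endian digit strings starting at position j; the last conjunct of Numeral
-- excludes a most significant digit 0.
value : ℕ → List ℕ → ℕ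
value j [] = 0
value j (a ∷ l) = a + radix j * value (suc j) l

Numeral : ℕ → List ℕ → Set
Numeral j [] = ⊤
Numeral j (a ∷ l) = a < radix j × Numeral (suc j) l × (l ≡ [] → 0 < a)

record Represents (j : ℕ) (l : List ℕ) (n : ℕ) : Set where
  constructor _,_
  field
    isNumeral : Numeral j l
    value≡ : value j l ≡ n
open Represents

0<radix : ∀ j → 0 < radix j
0<radix j = ≤-trans (n≤1+n 1) (2≤radix j)

0<value : ∀ {j a l} → Numeral j (a ∷ l) → 0 < value j (a ∷ l)
0<value {j} {a} {[]} (_ , _ , 0<a) = ≤-trans (0<a refl) (m≤m+n a _)
0<value {j} {a} {b ∷ l} (_ , nl , _) = ≤-trans (≤-trans (0<value nl) (m≤n*m _ (radix j) {{>-nonZero (0<radix j)}})) (m≤n+m _ a)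

value<value : ∀ {M a b x y} → a < M → x < y → a + M * x < b + M * y
value<value {M} {a} {b} {x} {y} a<M x<y = begin-strict
  a + M * x   <⟨ +-monoˡ-< (M * x) a<M ⟩
  M + M * x   ≡⟨ sym (*-suc M x) ⟩
  M * suc x   ≤⟨ *-monoʳ-≤ M x<y ⟩
  M * y       ≤⟨ m≤n+m (M * y) b ⟩
  b + M * y   ∎
  where open ≤-Reasoning

numeral-unique : ∀ {j l l′} → Numeral j l → Numeral j l′ → value j l ≡ value j l′ → l ≡ l′
numeral-unique {l = []} {[]} _ _ _ = refl
numeral-unique {l = []} {b ∷ w} _ nw v≡ = ⊥-elim (<⇒≢ (0<value nw) v≡)
numeral-unique {l = a ∷ l} {[]} nl _ v≡ = ⊥-elim (<⇒≢ (0<value nl) (sym v≡))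
numeral-unique {j} {a ∷ l} {b ∷ w} (a< , nl , _) (b< , nw , _) v≡ with <-cmp (value (suc j) l) (value (suc j) w)
... | tri< vl<vw _ _ = ⊥-elim (<⇒≢ (value<value a< vl<vw) v≡)
... | tri> _ _ vw<vl = ⊥-elim (<⇒≢ (value<value b< vw<vl) (sym v≡))
... | tri≈ _ vl≡vw _ = cong₂ _∷_ (+-cancelʳ-≡ _ a b (trans v≡ (cong (λ v → b + radix j * v) (sym vl≡vw))))
                                (numeral-unique nl nw vl≡vw)

increment : ℕ → List ℕ → List ℕ
increment j [] = 1 ∷ []
increment j (a ∷ l) = ifz (χ< (suc a) (radix j)) (0 ∷ increment (suc j) l) (suc a ∷ l)

increment≢[] : ∀ j l → increment j l ≢ []
increment≢[] j [] ()
increment≢[] j (a ∷ l) with χ< (suc a) (radix j)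
... | zero = λ ()
... | suc _ = λ ()

increment-represents : ∀ {j l n} → Represents j l n → Represents j (increment j l) (suc n)
increment-represents {j} {[]} (_ , refl) =
  (≤-trans (s≤s (s≤s z≤n)) (2≤radix j) , tt , λ _ → z<s) , cong suc (*-zeroʳ (radix j))
increment-represents {j} {a ∷ l} ((a< , nl , lead) , refl) with <-≤-connex (suc a) (radix j)
... | inj₁ 1+a< rewrite χ<≡1 1+a< = (1+a< , nl , λ _ → z<s) , refl
... | inj₂ radix≤1+a rewrite χ<≡0 radix≤1+a with increment-represents {suc j} {l} (nl , refl)
...   | nl′ , v≡ = (0<radix j , nl′ , λ e → ⊥-elim (increment≢[] (suc j) l e)) , (begin
  radix j * value (suc j) (increment (suc j) l) ≡⟨ cong (radix j *_) v≡ ⟩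
  radix j * suc (value (suc j) l)                ≡⟨ *-suc (radix j) _ ⟩
  radix j + radix j * value (suc j) l            ≡⟨ cong (_+ radix j * value (suc j) l) (≤-antisym radix≤1+a a<) ⟩
  suc a + radix j * value (suc j) l ∎)
  where open ≡-Reasoning

add : ℕ → List ℕ → List ℕ → List ℕ
add j [] w = w
add j (a ∷ l) [] = a ∷ l
add j (a ∷ l) (b ∷ w) = ifz (χ< (a + b) (radix j))
  ((a + b ∸ radix j) ∷ increment (suc j) (add (suc j) l w))
  ((a + b) ∷ add (suc j) l w)

add≡[]⇒ˡ≡[] : ∀ j l w → add j l w ≡ [] → l ≡ []
add≡[]⇒ˡ≡[] j [] w _ = refl
add≡[]⇒ˡ≡[] j (a ∷ l) (b ∷ w) e with χ< (a + b) (radix j)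
add≡[]⇒ˡ≡[] j (a ∷ l) (b ∷ w) () | zero
add≡[]⇒ˡ≡[] j (a ∷ l) (b ∷ w) () | suc _

digitwise-+ : ∀ a b r x y → (a + b) + r * (x + y) ≡ (a + r * x) + (b + r * y)
digitwise-+ = solve 5 (λ a b r x y → (a :+ b) :+ r :* (x :+ y) := (a :+ r :* x) :+ (b :+ r :* y)) refl
  where open +-*-Solver

add-represents : ∀ {j l w m n} → Represents j l m → Represents j w n → Represents j (add j l w) (m + n)
add-represents {l = []} (_ , refl) rw = rw
add-represents {l = a ∷ l} {[]} rl (_ , refl) = isNumeral rl , trans (value≡ rl) (sym (+-identityʳ _))
add-represents {j} {a ∷ l} {b ∷ w} ((a< , nl , lead) , refl) ((b< , nw , _) , refl)
  with add-represents {suc j} {l} {w} (nl , refl) (nw , refl) | <-≤-connex (a + b) (radix j)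
... | (nR , vR) | inj₁ a+b< rewrite χ<≡1 a+b< =
  (a+b< , nR , λ R≡[] → ≤-trans (lead (add≡[]⇒ˡ≡[] (suc j) l w R≡[])) (m≤m+n a b)) ,
  trans (cong (λ v → a + b + radix j * v) vR) (digitwise-+ a b (radix j) _ _)
... | (nR , vR) | inj₂ radix≤a+b rewrite χ<≡0 radix≤a+b with increment-represents (nR , vR)
...   | (nR′ , vR′) = (digit< , nR′ , λ e → ⊥-elim (increment≢[] (suc j) (add (suc j) l w) e)) , (begin
  a + b ∸ r + r * value (suc j) (increment (suc j) (add (suc j) l w))
    ≡⟨ cong (λ v → a + b ∸ r + r * v) vR′ ⟩
  a + b ∸ r + r * suc (vl + vw)   ≡⟨ cong (a + b ∸ r +_) (*-suc r (vl + vw)) ⟩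
  a + b ∸ r + (r + r * (vl + vw)) ≡⟨ sym (+-assoc (a + b ∸ r) r _) ⟩
  a + b ∸ r + r + r * (vl + vw)   ≡⟨ cong (_+ r * (vl + vw)) (m∸n+n≡m radix≤a+b) ⟩
  a + b + r * (vl + vw)           ≡⟨ digitwise-+ a b r vl vw ⟩
  a + r * vl + (b + r * vw) ∎)
  where
  open ≡-Reasoning
  r vl vw : ℕ
  r = radix j
  vl = value (suc j) l
  vw = value (suc j) w
  digit< : a + b ∸ r < r
  digit< = +-cancelʳ-< _ _ r (subst (_< r + r) (sym (m∸n+n≡m radix≤a+b)) (+-mono-< a< b<))

Compares : ℕ → ℕ → ℕ → Set
Compares r x y = (r ≡ 0 × x ≡ y) ⊎ (r ≡ 1 × x < y) ⊎ (r ≡ 2 × y < x)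

compareℕ : ℕ → ℕ → ℕ
compareℕ a b = ifz (χ< a b) (ifz (χ< b a) 0 2) 1

compareℕ-compares : ∀ a b → Compares (compareℕ a b) a b
compareℕ-compares a b with <-cmp a b
... | tri< a<b _ _ rewrite χ<≡1 a<b = inj₂ (inj₁ (refl , a<b))
... | tri≈ _ refl _ rewrite χ<≡0 (≤-refl {a}) = inj₁ (refl , refl)
... | tri> _ _ b<a rewrite χ<≡0 (<⇒≤ b<a) | χ<≡1 b<a = inj₂ (inj₂ (refl , b<a))

compareDigits : List ℕ → List ℕ → ℕ
compareDigits [] [] = 0
compareDigits [] (b ∷ w) = 1
compareDigits (a ∷ l) [] = 2
compareDigits (a ∷ l) (b ∷ w) = ifz (compareDigits l w) (compareℕ a b) (compareDigits l w)

compareDigits-compares : ∀ {j l w} → Numeral j l → Numeral j w → Compares (compareDigits l w) (value j l) (value j w)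
compareDigits-compares {l = []} {[]} _ _ = inj₁ (refl , refl)
compareDigits-compares {l = []} {b ∷ w} _ nw = inj₂ (inj₁ (refl , 0<value nw))
compareDigits-compares {l = a ∷ l} {[]} nl _ = inj₂ (inj₂ (refl , 0<value nl))
compareDigits-compares {j} {a ∷ l} {b ∷ w} (a< , nl , _) (b< , nw , _) with compareDigits-compares nl nw
... | inj₂ (inj₁ (r≡1 , vl<vw)) rewrite r≡1 = inj₂ (inj₁ (refl , value<value a< vl<vw))
... | inj₂ (inj₂ (r≡2 , vw<vl)) rewrite r≡2 = inj₂ (inj₂ (refl , value<value b< vw<vl))
... | inj₁ (r≡0 , vl≡vw) rewrite r≡0 | vl≡vw with compareℕ-compares a b
...   | inj₁ (c≡0 , refl) = inj₁ (c≡0 , refl)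
...   | inj₂ (inj₁ (c≡1 , a<b)) = inj₂ (inj₁ (c≡1 , +-monoˡ-< _ a<b))
...   | inj₂ (inj₂ (c≡2 , b<a)) = inj₂ (inj₂ (c≡2 , +-monoˡ-< _ b<a))

compares-≤ : ∀ {r x y} → Compares r x y → Indicates (χ< r 2) (x ≤ y)
compares-≤ (inj₁ (refl , refl)) = inj₁ (refl , ≤-refl)
compares-≤ (inj₂ (inj₁ (refl , x<y))) = inj₁ (refl , <⇒≤ x<y)
compares-≤ (inj₂ (inj₂ (refl , y<x))) = inj₂ (refl , <⇒≱ y<x)

incrementStep : ℕ → ℕ → ℕ → ℕ → ℕ → ℕ
incrementStep j a t _ r = ifz (χ<radix j (suc a)) (cons 0 r) (cons (suc a) t)

incrementBase : ℕ → ℕ → ℕ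
incrementBase _ _ = ⌜ 1 ∷ [] ⌝

module IncrementCode = CodeRecursion incrementBase incrementStep

incrementCode : ℕ → ℕ → ℕ
incrementCode j u = IncrementCode.listRec j (decode u) 0

pr-incrementCode : PrimRec₂ incrementCode
pr-incrementCode = curry₂ (app₃ (IncrementCode.pr-listRec (curry₂ (pr-const ⌜ 1 ∷ [] ⌝)) pr-step) var₀ var₁ (pr-const 0))
  where
  pr-step : PrimRec₅ incrementStep
  pr-step = curry₅ (app₃ pr-ifz (app₂ pr-χ<radix var₀ (pr-suc var₁))
                               (app₂ pr-cons (pr-const 0) var₄) (app₂ pr-cons (pr-suc var₁) var₂))

incrementCode-code : ∀ j l → incrementCode j ⌜ l ⌝ ≡ ⌜ increment j l ⌝
incrementCode-code j l = trans (cong (λ l′ → IncrementCode.listRec j l′ 0) (decode-code l)) (listRec≡ j l 0)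
  where
  listRec≡ : ∀ j l v → IncrementCode.listRec j l v ≡ ⌜ increment j l ⌝
  listRec≡ j [] v = refl
  listRec≡ j (a ∷ l) v =
    trans (cong₂ (λ c r → ifz c (cons 0 r) (cons (suc a) ⌜ l ⌝)) (χ<radix-spec j (suc a)) (listRec≡ (suc j) l (tl v)))
          (sym (ifz-map ⌜_⌝ (χ< (suc a) (radix j)) _ _))

-- s is the sum of the digits at position j, and r codes the sum of the higher parts.
addDigitCode : ℕ → ℕ → ℕ → ℕ
addDigitCode j s r = ifz (χ<radix j s) (cons (s ∸ cappedRadix j s) (incrementCode (suc j) r)) (cons s r)

addStep : ℕ → ℕ → ℕ → ℕ → ℕ → ℕ
addStep j a t v r = ifz v (cons a t) (addDigitCode j (a + hd v) r)

addBase : ℕ → ℕ → ℕ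
addBase _ v = v

module AddCode = CodeRecursion addBase addStep

addCode : ℕ → ℕ → ℕ
addCode u v = AddCode.listRec 0 (decode u) v

pr-addCode : PrimRec₂ addCode
pr-addCode = curry₂ (app₃ (AddCode.pr-listRec (curry₂ var₁) pr-step) (pr-const 0) var₀ var₁)
  where
  pr-addDigitCode : PrimRec₃ addDigitCode
  pr-addDigitCode = curry₃ (app₃ pr-ifz (app₂ pr-χ<radix var₀ var₁)
    (app₂ pr-cons (app₂ pr-∸ var₁ (app₂ pr-cappedRadix var₀ var₁)) (app₂ pr-incrementCode (pr-suc var₀) var₂))
    (app₂ pr-cons var₁ var₂))
  pr-step : PrimRec₅ addStep
  pr-step = curry₅ (app₃ pr-ifz var₃ (app₂ pr-cons var₁ var₂)
                                    (app₃ pr-addDigitCode var₀ (app₂ pr-+ var₁ (app₁ pr-hd var₃)) var₄))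

addDigitCode-code : ∀ j s R →
                    addDigitCode j s ⌜ R ⌝ ≡ ⌜ ifz (χ< s (radix j)) ((s ∸ radix j) ∷ increment (suc j) R) (s ∷ R) ⌝
addDigitCode-code j s R with <-≤-connex s (radix j)
... | inj₁ s<radix = trans (ifz-1 (trans (χ<radix-spec j s) (χ<≡1 s<radix))) (cong ⌜_⌝ (sym (ifz-1 (χ<≡1 s<radix))))
... | inj₂ radix≤s = trans (ifz-0 (trans (χ<radix-spec j s) (χ<≡0 radix≤s)))
  (trans (cong₂ (λ d r → cons (s ∸ d) r) (cappedRadix-≥ radix≤s) (incrementCode-code (suc j) R))
         (cong ⌜_⌝ (sym (ifz-0 (χ<≡0 radix≤s)))))

addCode-code : ∀ l w → addCode ⌜ l ⌝ ⌜ w ⌝ ≡ ⌜ add 0 l w ⌝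
addCode-code l w = trans (cong (λ l′ → AddCode.listRec 0 l′ ⌜ w ⌝) (decode-code l)) (listRec≡ 0 l w)
  where
  listRec≡ : ∀ j l w → AddCode.listRec j l ⌜ w ⌝ ≡ ⌜ add j l w ⌝
  listRec≡ j [] w = refl
  listRec≡ j (a ∷ l) [] = refl
  listRec≡ j (a ∷ l) (b ∷ w) rewrite hd-cons b ⌜ w ⌝ | tl-cons b ⌜ w ⌝ | listRec≡ (suc j) l w =
    addDigitCode-code j (a + b) (add (suc j) l w)

compareStep : ℕ → ℕ → ℕ → ℕ → ℕ → ℕ
compareStep _ a _ v r = ifz v 2 (ifz r (compareℕ a (hd v)) r)

compareBase : ℕ → ℕ → ℕ
compareBase _ v = ifz v 0 1

module CompareCode = CodeRecursion compareBase compareStep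

compareCode : ℕ → ℕ → ℕ
compareCode u v = CompareCode.listRec 0 (decode u) v

pr-compareCode : PrimRec₂ compareCode
pr-compareCode = curry₂ (app₃ (CompareCode.pr-listRec pr-base pr-step) (pr-const 0) var₀ var₁)
  where
  pr-compareℕ : PrimRec₂ compareℕ
  pr-compareℕ = curry₂ (app₃ pr-ifz (app₂ pr-χ< var₀ var₁)
                                    (app₃ pr-ifz (app₂ pr-χ< var₁ var₀) (pr-const 0) (pr-const 2)) (pr-const 1))
  pr-base : PrimRec₂ compareBase
  pr-base = curry₂ (app₃ pr-ifz var₁ (pr-const 0) (pr-const 1))
  pr-step : PrimRec₅ compareStep
  pr-step = curry₅ (app₃ pr-ifz var₃ (pr-const 2) (app₃ pr-ifz var₄ (app₂ pr-compareℕ var₁ (app₁ pr-hd var₃)) var₄))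

compareCode-code : ∀ l w → compareCode ⌜ l ⌝ ⌜ w ⌝ ≡ compareDigits l w
compareCode-code l w = trans (cong (λ l′ → CompareCode.listRec 0 l′ ⌜ w ⌝) (decode-code l)) (listRec≡ 0 l w)
  where
  listRec≡ : ∀ j l w → CompareCode.listRec j l ⌜ w ⌝ ≡ compareDigits l w
  listRec≡ j [] [] = refl
  listRec≡ j [] (b ∷ w) = refl
  listRec≡ j (a ∷ l) [] = refl
  listRec≡ j (a ∷ l) (b ∷ w) rewrite hd-cons b ⌜ w ⌝ | tl-cons b ⌜ w ⌝ | listRec≡ (suc j) l w = refl

leading-indicates : ∀ a l → Indicates (ifz ⌜ l ⌝ (ifz a 0 1) 1) (l ≡ [] → 0 < a)
leading-indicates zero [] = inj₂ (refl , λ lead → <-irrefl refl (lead refl))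
leading-indicates (suc a) [] = inj₁ (refl , λ _ → z<s)
leading-indicates a (b ∷ l) = inj₁ (refl , λ ())

validStep : ℕ → ℕ → ℕ → ℕ → ℕ → ℕ
validStep j a t _ r = χ<radix j a * (r * ifz t (ifz a 0 1) 1)

validBase : ℕ → ℕ → ℕ
validBase _ _ = 1

module ValidCode = CodeRecursion validBase validStep

validCode : ℕ → ℕ
validCode u = ValidCode.listRec 0 (decode u) 0

pr-validCode : PrimRec₁ validCode
pr-validCode = curry₁ (app₃ (ValidCode.pr-listRec (curry₂ (pr-const 1)) pr-step) (pr-const 0) var₀ (pr-const 0))
  where
  pr-step : PrimRec₅ validStep
  pr-step = curry₅ (app₂ pr-* (app₂ pr-χ<radix var₀ var₁)
                              (app₂ pr-* var₄ (app₃ pr-ifz var₂ (app₃ pr-ifz var₁ (pr-const 0) (pr-const 1)) (pr-const 1))))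

Valid : ℕ → Set
Valid u = Numeral 0 (decode u)

code-valid : ∀ {l} → Numeral 0 l → Valid ⌜ l ⌝
code-valid {l} nl = subst (Numeral 0) (sym (decode-code l)) nl

validCode-indicates : ∀ u → Indicates (validCode u) (Valid u)
validCode-indicates u = listRec-indicates 0 (decode u) 0
  where
  listRec-indicates : ∀ j l v → Indicates (ValidCode.listRec j l v) (Numeral j l)
  listRec-indicates j [] v = inj₁ (refl , _)
  listRec-indicates j (a ∷ l) v =
    Indicates-× (subst (λ b → Indicates b (a < radix j)) (sym (χ<radix-spec j a)) (χ<-indicates a (radix j)))
                (Indicates-× (listRec-indicates (suc j) l (tl v)) (leading-indicates a l))

-- Numbering the valid codes

rank : ℕ → ℕ
rank u = sumBelow validCode u

pr-rank : PrimRec₁ rank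
pr-rank = curry₁ (pr-sumBelow (app₁ pr-validCode var₀))

rank≤ : ∀ u → rank u ≤ u
rank≤ zero = z≤n
rank≤ (suc u) = ≤-trans (+-mono-≤ (rank≤ u) (indicates-≤1 (validCode-indicates u))) (≤-reflexive (+-comm u 1))

rank-mono-≤ : ∀ {u w} → u ≤ w → rank u ≤ rank w
rank-mono-≤ = stepwise-mono-≤ rank (λ u → m≤m+n (rank u) (validCode u))

rank-suc-valid : ∀ {u} → Valid u → rank (suc u) ≡ suc (rank u)
rank-suc-valid {u} valid = trans (cong (rank u +_) (indicates-≡1 (validCode-indicates u) valid)) (+-comm (rank u) 1)

rank-strict : ∀ {u w} → Valid u → u < w → rank u < rank w
rank-strict valid u<w = ≤-trans (≤-reflexive (sym (rank-suc-valid valid))) (rank-mono-≤ u<w)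

rank-gap : ∀ {u w} → u ≤ w → (∀ v → u ≤ v → v < w → ¬ Valid v) → rank w ≡ rank u
rank-gap u≤w gap = go (≤⇒≤′ u≤w) gap
  where
  go : ∀ {u w} → u ≤′ w → (∀ v → u ≤ v → v < w → ¬ Valid v) → rank w ≡ rank u
  go ≤′-refl _ = refl
  go {u} (≤′-step {w} u≤′w) gap =
    trans (cong (rank w +_) (indicates-≡0 (validCode-indicates w) (gap w (≤′⇒≤ u≤′w) ≤-refl)))
          (trans (+-identityʳ (rank w)) (go u≤′w (λ v u≤v v<w → gap v u≤v (m<n⇒m<1+n v<w))))

unit : ℕ → List ℕ
unit zero = 1 ∷ []
unit (suc k) = 0 ∷ unit k

unit≢[] : ∀ k → unit k ≢ []
unit≢[] zero ()
unit≢[] (suc k) ()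

unit-numeral : ∀ j k → Numeral j (unit k)
unit-numeral j zero = ≤-trans (s≤s (s≤s z≤n)) (2≤radix j) , tt , λ _ → z<s
unit-numeral j (suc k) = 0<radix j , unit-numeral (suc j) k , λ e → ⊥-elim (unit≢[] k e)

pr-unitCode : PrimRec₁ (λ k → ⌜ unit k ⌝)
pr-unitCode = pr-ext₁ natRec≡ (pr-rec (pr-const ⌜ 1 ∷ [] ⌝) (app₂ pr-cons (pr-const 0) var₀))
  where
  natRec≡ : ∀ k → natRec ⌜ 1 ∷ [] ⌝ (λ _ u → cons 0 u) k ≡ ⌜ unit k ⌝
  natRec≡ zero = refl
  natRec≡ (suc k) = cong (cons 0) (natRec≡ k)

n<unitCode : ∀ k → k < ⌜ unit k ⌝
n<unitCode k = <-≤-trans (n<length k) (length≤code (unit k))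
  where
  n<length : ∀ k → k < length (unit k)
  n<length zero = z<s
  n<length (suc k) = s≤s (n<length k)

validAbove : ℕ → ℕ → ℕ
validAbove r v = validCode v * χ< r v

validAbove-indicates : ∀ r v → Indicates (validAbove r v) (Valid v × r < v)
validAbove-indicates r v = Indicates-× (validCode-indicates v) (χ<-indicates r v)

-- The code of unit r is valid and above r, so it bounds the search.
next : ℕ → ℕ
next r = μBelow (validAbove r) (suc ⌜ unit r ⌝)

pr-next : PrimRec₁ next
pr-next = curry₁ (app₂ pr-search (pr-suc (app₁ pr-unitCode var₀)) var₀)
  where
  pr-search : PrimRec₂ (λ y r → μBelow (validAbove r) y)
  pr-search = curry₂ (pr-μBelow (app₂ pr-* (app₁ pr-validCode var₀) (app₂ pr-χ< var₁ var₀)))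

record IsNext (r v : ℕ) : Set where
  field
    valid : Valid v
    above : r < v
    gap : ∀ w → r < w → w < v → ¬ Valid w

next-isNext : ∀ r → IsNext r (next r)
next-isNext r = record { valid = proj₁ next-holds ; above = proj₂ next-holds ; gap = gap-below }
  where
  least : IsLeastBelow (validAbove r) (suc ⌜ unit r ⌝) (next r)
  least = μBelow-isLeast (validAbove r) (suc ⌜ unit r ⌝)
  next<bound : next r < suc ⌜ unit r ⌝
  next<bound with m≤n⇒m<n∨m≡n (bound least)
  ... | inj₁ next< = next<
  ... | inj₂ next≡ = ⊥-elim (indicates-fails (validAbove-indicates r ⌜ unit r ⌝)
                              (below least ⌜ unit r ⌝ (subst (⌜ unit r ⌝ <_) (sym next≡) ≤-refl))
                              (code-valid (unit-numeral 0 r) , n<unitCode r))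
  next-holds : Valid (next r) × r < next r
  next-holds = indicates-holds (validAbove-indicates r (next r)) (found least next<bound)
  gap-below : ∀ w → r < w → w < next r → ¬ Valid w
  gap-below w r<w w<next valid = indicates-fails (validAbove-indicates r w) (below least w w<next) (valid , r<w)

rank-next : ∀ {r} → Valid r → rank (next r) ≡ suc (rank r)
rank-next {r} valid = trans (rank-gap (IsNext.above isNext) (λ v r<v → IsNext.gap isNext v r<v)) (rank-suc-valid valid)
  where
  isNext : IsNext r (next r)
  isNext = next-isNext r

unrank : ℕ → ℕ
unrank i = natRec 0 (λ _ r → next r) i

pr-unrank : PrimRec₁ unrank
pr-unrank = curry₁ (pr-rec pr-zero (app₁ pr-next var₀))

unrank-valid : ∀ i → Valid (unrank i)
unrank-valid zero = tt
unrank-valid (suc i) = IsNext.valid (next-isNext (unrank i))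

rank-unrank : ∀ i → rank (unrank i) ≡ i
rank-unrank zero = refl
rank-unrank (suc i) = trans (rank-next (unrank-valid i)) (cong suc (rank-unrank i))

unrank-rank : ∀ {u} → Valid u → unrank (rank u) ≡ u
unrank-rank {u} valid with <-cmp (unrank (rank u)) u
... | tri≈ _ e _ = e
... | tri< lt _ _ = ⊥-elim (<-irrefl (rank-unrank (rank u)) (rank-strict (unrank-valid (rank u)) lt))
... | tri> _ _ gt = ⊥-elim (<-irrefl (sym (rank-unrank (rank u))) (rank-strict valid gt))

numeral : ℕ → List ℕ
numeral zero = []
numeral (suc n) = increment 0 (numeral n)

numeral-represents : ∀ n → Represents 0 (numeral n) n
numeral-represents zero = tt , refl
numeral-represents (suc n) = increment-represents (numeral-represents n)

toCopy : ℕ → ℕ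
toCopy n = rank ⌜ numeral n ⌝

fromCopy : ℕ → ℕ
fromCopy x = value 0 (decode (unrank x))

unrank-toCopy : ∀ n → unrank (toCopy n) ≡ ⌜ numeral n ⌝
unrank-toCopy n = unrank-rank (code-valid (isNumeral (numeral-represents n)))

toCopy-represents : ∀ {l n} → Represents 0 l n → toCopy n ≡ rank ⌜ l ⌝
toCopy-represents {n = n} rl = cong (λ l → rank ⌜ l ⌝)
  (numeral-unique (isNumeral (numeral-represents n)) (isNumeral rl) (trans (value≡ (numeral-represents n)) (sym (value≡ rl))))

unrank-represents : ∀ x → Represents 0 (decode (unrank x)) (fromCopy x)
unrank-represents x = unrank-valid x , refl

fromCopy-toCopy : ∀ n → fromCopy (toCopy n) ≡ n
fromCopy-toCopy n = trans (cong (λ u → value 0 (decode u)) (unrank-toCopy n))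
                          (trans (cong (value 0) (decode-code (numeral n))) (value≡ (numeral-represents n)))

toCopy-fromCopy : ∀ x → toCopy (fromCopy x) ≡ x
toCopy-fromCopy x = trans (toCopy-represents (unrank-represents x)) (trans (cong rank (code-decode (unrank x))) (rank-unrank x))

copy : ℕ ↔ ℕ
copy = mk↔ₛ′ toCopy fromCopy toCopy-fromCopy fromCopy-toCopy

successor : ℕ → ℕ
successor x = rank (incrementCode 0 (unrank x))

pr-successor : PrimRec₁ successor
pr-successor = curry₁ (app₁ pr-rank (app₂ pr-incrementCode (pr-const 0) (app₁ pr-unrank var₀)))

copy-isCopyIso : IsCopyIso successor copy
copy-isCopyIso n = sym (cong rank (trans (cong (incrementCode 0) (unrank-toCopy n)) (incrementCode-code 0 (numeral n))))

pr-+-copy : PrimRec₂ (image₂ copy _+_)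
pr-+-copy = pr-ext₂ plus≡ (app₁ pr-rank (app₂ pr-addCode (app₁ pr-unrank var₀) (app₁ pr-unrank var₁)))
  where
  plus≡ : ∀ x y → rank (addCode (unrank x) (unrank y)) ≡ toCopy (fromCopy x + fromCopy y)
  plus≡ x y = begin
    rank (addCode (unrank x) (unrank y))
      ≡⟨ cong rank (cong₂ addCode (sym (code-decode (unrank x))) (sym (code-decode (unrank y)))) ⟩
    rank (addCode ⌜ decode (unrank x) ⌝ ⌜ decode (unrank y) ⌝)
      ≡⟨ cong rank (addCode-code (decode (unrank x)) (decode (unrank y))) ⟩
    rank ⌜ add 0 (decode (unrank x)) (decode (unrank y)) ⌝
      ≡⟨ sym (toCopy-represents (add-represents (unrank-represents x) (unrank-represents y))) ⟩
    toCopy (fromCopy x + fromCopy y) ∎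
    where open ≡-Reasoning

leq : ℕ → ℕ → ℕ
leq x y = χ< (compareCode (unrank x) (unrank y)) 2

pr-leq : PrimRec₂ leq
pr-leq = curry₂ (app₂ pr-χ< (app₂ pr-compareCode (app₁ pr-unrank var₀) (app₁ pr-unrank var₁)) (pr-const 2))

leq-indicates : ∀ x y → Indicates (leq x y) (fromCopy x ≤ fromCopy y)
leq-indicates x y = subst (λ r → Indicates (χ< r 2) (fromCopy x ≤ fromCopy y))
  (sym (trans (cong₂ compareCode (sym (code-decode (unrank x))) (sym (code-decode (unrank y))))
              (compareCode-code (decode (unrank x)) (decode (unrank y)))))
  (compares-≤ (compareDigits-compares (unrank-valid x) (unrank-valid y)))

pr-≤-copy : PrimRecRel₂ (imageRel₂ copy _≤_)
pr-≤-copy = proj₁ pr-leq , λ x y →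
  subst (λ b → Indicates b (fromCopy x ≤ fromCopy y)) (sym (proj₂ pr-leq x y)) (leq-indicates x y)

span : ℕ → ℕ → ℕ
span i zero = 1
span i (suc k) = radix i * span (suc i) k

place≡span : ∀ k → place k ≡ span 0 k
place≡span k = trans (place-+ 0 k) (*-identityˡ (span 0 k))
  where
  place-+ : ∀ i k → place (i + k) ≡ place i * span i k
  place-+ i zero = trans (cong place (+-identityʳ i)) (sym (*-identityʳ (place i)))
  place-+ i (suc k) = trans (cong place (+-suc i k)) (trans (place-+ (suc i) k) (*-assoc (place i) (radix i) (span (suc i) k)))

value-unit : ∀ i k → value i (unit k) ≡ span i k
value-unit i zero = cong suc (*-zeroʳ (radix i))
value-unit i (suc k) = cong (radix i *_) (value-unit (suc i) k)

lastDigit : List ℕ → ℕ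
lastDigit [] = 0
lastDigit (a ∷ []) = a
lastDigit (a ∷ b ∷ l) = lastDigit (b ∷ l)

lastDigit≤code : ∀ l → lastDigit l ≤ ⌜ l ⌝
lastDigit≤code [] = z≤n
lastDigit≤code (a ∷ []) = <⇒≤ (head<cons a 0)
lastDigit≤code (a ∷ b ∷ l) = ≤-trans (lastDigit≤code (b ∷ l)) (<⇒≤ (<cons a ⌜ b ∷ l ⌝))

span≤value : ∀ {i a l} → Numeral i (a ∷ l) → span i (length l) ≤ value i (a ∷ l)
span≤value {i} {a} {[]} (_ , _ , lead) = ≤-trans (lead refl) (m≤m+n a _)
span≤value {i} {a} {b ∷ l} (_ , nl , _) = ≤-trans (*-monoʳ-≤ (radix i) (span≤value nl)) (m≤n+m _ a)

value<span*lastDigit : ∀ {i l} → Numeral i l → value i l < span i (pred (length l)) * suc (lastDigit l)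
value<span*lastDigit {i} {[]} _ = z<s
value<span*lastDigit {i} {a ∷ []} _ = s≤s (≤-reflexive (cong (a +_) (*-zeroʳ (radix i))))
value<span*lastDigit {i} {a ∷ b ∷ l} (a< , nl , _) =
  <-≤-trans (value<value {b = 0} a< (value<span*lastDigit nl))
            (≤-reflexive (sym (*-assoc (radix i) (span (suc i) (length l)) (suc (lastDigit (b ∷ l))))))

-- A value below place (suc j) has at most j + 1 digits, so a value above place j * place j
-- forces the top digit to be at least place j.
place≤code : ∀ {j l} → Numeral 0 l → place j * place j < value 0 l → value 0 l < place (suc j) → place j ≤ ⌜ l ⌝
place≤code {j} {[]} _ square<value _ = ⊥-elim (n≮0 square<value)
place≤code {j} {a ∷ l} nl square<value value<place = ≤-trans (≤-pred place<1+last) (lastDigit≤code (a ∷ l))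
  where
  length≤j : length l ≤ j
  length≤j = ≮⇒≥ λ j<length → <⇒≱ value<place
    (≤-trans (place-mono-≤ j<length) (≤-trans (≤-reflexive (place≡span (length l))) (span≤value nl)))
  place<1+last : place j < suc (lastDigit (a ∷ l))
  place<1+last = *-cancelˡ-< (place j) _ _ (<-≤-trans square<value (<⇒≤ (<-≤-trans (value<span*lastDigit nl)
                   (*-monoˡ-≤ _ (≤-trans (≤-reflexive (sym (place≡span (length l)))) (place-mono-≤ length≤j))))))

ack<place : ∀ {k j} → suc k < j → ack k j < place j
ack<place {k} {suc j} (s≤s 1+k≤j) = begin-strict
  ack k (suc j)    ≤⟨ ack-suc≤ack-suc k j ⟩
  ack (suc k) j    ≤⟨ ack-mono-≤ 1+k≤j (<⇒≤ (n<place j)) ⟩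
  ack j (place j)  <⟨ ack<radix j ⟩
  radix j          ≤⟨ radix≤place-suc j ⟩
  place (suc j)    ∎
  where open ≤-Reasoning

ack-place<place-suc : ∀ {k j} → k ≤ j → ack k (place j) < place (suc j)
ack-place<place-suc {k} {j} k≤j = <-≤-trans (≤-<-trans (ack-monoˡ-≤ (place j) k≤j) (ack<radix j)) (radix≤place-suc j)

toCopy-place : ∀ j → toCopy (place j) ≡ rank ⌜ unit j ⌝
toCopy-place j = toCopy-represents (unit-numeral 0 j , trans (value-unit 0 j) (sym (place≡span j)))

image-code-bound : ∀ f → PrimRec₁ (image₁ copy f) → ∃ λ K → ∀ j → ⌜ numeral (f (place j)) ⌝ < ack K j
image-code-bound f pq with ack-dominates pq
... | kq , q< = suc (suc (ku ⊔ suc (suc (kq ⊔ kU)))) , λ j → begin-strict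
  ⌜ numeral (f (place j)) ⌝                  ≡⟨ sym (unrank-toCopy (f (place j))) ⟩
  unrank (toCopy (f (place j)))              ≡⟨ cong (λ n → unrank (toCopy (f n))) (sym (fromCopy-toCopy (place j))) ⟩
  unrank (image₁ copy f (toCopy (place j)))  <⟨ unrank< (image₁ copy f (toCopy (place j))) ⟩
  ack ku (image₁ copy f (toCopy (place j)))  ≤⟨ ack-monoʳ-≤ ku (<⇒≤ (q< (toCopy (place j)))) ⟩
  ack ku (ack kq (toCopy (place j)))         ≤⟨ ack-monoʳ-≤ ku (ack-monoʳ-≤ kq (toCopy-place≤ j)) ⟩
  ack ku (ack kq (ack kU j))                 ≤⟨ ack-monoʳ-≤ ku (<⇒≤ (ack-comp kq kU j)) ⟩
  ack ku (ack (suc (suc (kq ⊔ kU))) j)       <⟨ ack-comp ku (suc (suc (kq ⊔ kU))) j ⟩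
  ack (suc (suc (ku ⊔ suc (suc (kq ⊔ kU))))) j ∎
  where
  open ≤-Reasoning
  ku kU : ℕ
  ku = proj₁ (ack-dominates pr-unrank)
  kU = proj₁ (ack-dominates pr-unitCode)
  unrank< : ∀ i → unrank i < ack ku i
  unrank< = proj₂ (ack-dominates pr-unrank)
  unitCode< : ∀ k → ⌜ unit k ⌝ < ack kU k
  unitCode< = proj₂ (ack-dominates pr-unitCode)
  toCopy-place≤ : ∀ j → toCopy (place j) ≤ ack kU j
  toCopy-place≤ j = ≤-trans (≤-reflexive (toCopy-place j)) (≤-trans (rank≤ ⌜ unit j ⌝) (<⇒≤ (unitCode< j)))

image-not-pr : (f : ℕ → ℕ) → PrimRec₁ f → EventuallyAboveSquare f → ¬ PrimRec₁ (image₁ copy f)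
image-not-pr f pf (N , above) pq = <⇒≱ code<place (place≤code {j} (isNumeral rf) lower upper)
  where
  kf K M j : ℕ
  kf = proj₁ (ack-dominates pf)
  K = proj₁ (image-code-bound f pq)
  M = N ⊔ kf ⊔ K
  j = suc (suc M)
  M≤j : M ≤ j
  M≤j = ≤-trans (n≤1+n M) (n≤1+n (suc M))
  rf : Represents 0 (numeral (f (place j))) (f (place j))
  rf = numeral-represents (f (place j))
  code<place : ⌜ numeral (f (place j)) ⌝ < place j
  code<place = <-trans (proj₂ (image-code-bound f pq) j) (ack<place {K} {j} (s≤s (s≤s (m≤n⊔m (N ⊔ kf) K))))
  N≤place : N ≤ place j
  N≤place = ≤-trans (≤-trans (m≤m⊔n N kf) (m≤m⊔n (N ⊔ kf) K)) (≤-trans M≤j (<⇒≤ (n<place j)))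
  kf≤j : kf ≤ j
  kf≤j = ≤-trans (≤-trans (m≤n⊔m N kf) (m≤m⊔n (N ⊔ kf) K)) M≤j
  lower : place j * place j < value 0 (numeral (f (place j)))
  lower = subst (place j * place j <_) (sym (value≡ rf)) (above (place j) N≤place)
  upper : value 0 (numeral (f (place j))) < place (suc j)
  upper = subst (_< place (suc j)) (sym (value≡ rf))
                (<-trans (proj₂ (ack-dominates pf) (place j)) (ack-place<place-suc {kf} {j} kf≤j))

mainTheorem3 :
    Σ (ℕ → ℕ) λ sB → Σ (ℕ ↔ ℕ) λ c →
      IsCopyIso sB c
      × PrimRec₁ sB
      × PrimRecRel₂ (imageRel₂ c _≤_)
      × PrimRec₂ (image₂ c _+_)
      × ((f : ℕ → ℕ) → PrimRec₁ f → EventuallyAboveSquare f → ¬ PrimRec₁ (image₁ c f))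
mainTheorem3 = successor , copy , copy-isCopyIso , pr-successor , pr-≤-copy , pr-+-copy , image-not-pr
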